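{- Define $\tilde a(M)$ (rational functions of $q,y$) by $$\sum_{M\ge 0}\tilde{a}(M)x^M=\sum_{n_1,n_2,n_3\ge 0}\frac{(-1)^{n_3}x^{n_1+n_2+2n_3}y^{n_2+n_3}\,q^{4\binom{n_1}{2}+4\binom{n_2}{2}+18\binom{n_3}{2}+2n_1n_2+6n_2n_3+6n_3n_1+ n_1+2 n_2+9n_3}}{(q^2;q^2)_{n_1}(q^2;q^2)_{n_2}(q^6;q^6)_{n_3}}.$$ Then for any $M\ge 0$, \begin{align*} 0&=q^{12 M + 24} y^2 (1 + 2 yq + y^2q^2 + q^{6 M + 22} + yq^{6 M + 23} + y^2q^{6 M+ 24}) \tilde{a}(M)\\ &\quad - q^{12 M + 27} (1 + yq) (1 + yq + y^2q^2 - y^2q^8 + y^3q^3 + y^4q^4 + q^{6 M + 22} + y^2q^{6 M + 24} + y^4q^{6 M + 26}) \tilde{a}(M+1)\\ &\quad-q^{6 M + 17} \big(y + yq^2 + 2 y^2q + 2 y^2q^3 + y^3q^2 + y^3q^4 - q^{6 M + 15} + q^{6 M + 21} - 2 yq^{6 M + 16} + 2 yq^{6 M + 22} + yq^{6 M + 24} - yq^{12 M + 38}\\ &\quad\quad - 3 y^2q^{6 M + 17} + 2 y^2q^{6 M + 23} + y^2q^{6 M + 25} - y^2q^{12 M + 39} - 2 y^3q^{6 M + 18} + 2 y^3q^{6 M + 24} + y^3q^{6 M + 26} - y^3q^{12 M + 40}\\ &\quad\quad - y^4q^{6 M + 19} + y^4q^{6 M + 25}\big) \tilde{a}(M+2)\\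 &\quad -q^{6 M + 17} (1 + q^2 + q^4) (1 + yq) (1 + yq + yq^3 + y^2q^2 + q^{6 M + 20} + yq^{6 M + 21} + y^2q^{6 M + 22}) \tilde{a}(M+3)\\ &\quad+(1 - q^{6 M + 24}) (1 + 2 yq + y^2q^2 + q^{6 M + 16} + yq^{6 M + 17} + y^2q^{6 M + 18}) \tilde{a}(M+4). \end{align*}
   Context: The $q$-Pochhammer symbol is $(A;q)_n=\prod_{k=0}^{n-1}(1-Aq^k)$. -}

module Defs where

open import Level using (Level)
open import Algebra.Bundles using (CommutativeRing)
open import Data.Nat as ℕ using (ℕ; zero; suc; _∸_)
open import Data.Nat.Combinatorics using (_C_)
open import Data.Bool using (if_then_else_)
open import Relation.Nullary.Decidable using (⌊_⌋)

module QDefs {c ℓ : Level} (R : CommutativeRing c ℓ) where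
  open CommutativeRing R

  infixr 8 _^_
  _^_ : Carrier → ℕ → Carrier
  x ^ zero  = 1#
  x ^ suc n = x * (x ^ n)

  infixl 6 _⊖_
  _⊖_ : Carrier → Carrier → Carrier
  x ⊖ y = x + (- y)

  sumTo : ℕ → (ℕ → Carrier) → Carrier
  sumTo zero    f = 0#
  sumTo (suc n) f = sumTo n f + f n

  prodTo : ℕ → (ℕ → Carrier) → Carrier
  prodTo zero    f = 1#
  prodTo (suc n) f = prodTo n f * f n

  poch : Carrier → Carrier → ℕ → Carrier
  poch A q n = prodTo n (λ k → 1# ⊖ A * q ^ k)

  -- Given q and a family inv with (1 - q^(m+1)) * inv m ≈ 1 (i.e. inv m is
  -- the inverse of 1 - q^(m+1)), the inverse of (q^a;q^a)_n for a ≥ 1 is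
  -- Π_{k<n} (1 - q^(a(k+1)))⁻¹ :
  pochInv : (inv : ℕ → Carrier) → (a n : ℕ) → Carrier
  pochInv inv a n = prodTo n (λ k → inv (a ℕ.* suc k ∸ 1))

  term : (q y : Carrier) (inv : ℕ → Carrier) (n₁ n₂ n₃ : ℕ) → Carrier
  term q y inv n₁ n₂ n₃ =
    (- 1#) ^ n₃ * y ^ (n₂ ℕ.+ n₃)
      * q ^ (4 ℕ.* (n₁ C 2) ℕ.+ 4 ℕ.* (n₂ C 2) ℕ.+ 18 ℕ.* (n₃ C 2)
             ℕ.+ 2 ℕ.* n₁ ℕ.* n₂ ℕ.+ 6 ℕ.* n₂ ℕ.* n₃ ℕ.+ 6 ℕ.* n₃ ℕ.* n₁
             ℕ.+ n₁ ℕ.+ 2 ℕ.* n₂ ℕ.+ 9 ℕ.* n₃)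
      * pochInv inv 2 n₁ * pochInv inv 2 n₂ * pochInv inv 6 n₃

  -- ã(M) = coefficient of x^M: the (finite) sum of the terms with
  -- n1 + n2 + 2 n3 = M (each n_i ≤ M necessarily).
  ã : (q y : Carrier) (inv : ℕ → Carrier) (M : ℕ) → Carrier
  ã q y inv M =
    sumTo (suc M) λ n₁ → sumTo (suc M) λ n₂ → sumTo (suc M) λ n₃ →
      if ⌊ n₁ ℕ.+ n₂ ℕ.+ 2 ℕ.* n₃ ℕ.≟ M ⌋ then term q y inv n₁ n₂ n₃ else 0#

{-# OPTIONS --safe #-}
-- Grouping the summation by the weight of n₃ gives ã(M) = Σ_{K+2s=M} g(s,K) h(K), where
-- h(K) = Σ_{a+b=K} y^b q^(4(a C 2)+4(b C 2)+2ab+a+2b) / (q²;q²)_a (q²;q²)_b carries n₁, n₂ and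
-- g(s,K) = (-y)^s q^(18(s C 2)+9s+6sK) / (q⁶;q⁶)_s carries n₃ together with its cross terms.
-- h satisfies a three-term recurrence in K and g first-order recurrences in s and K.  For the
-- family A_j(M) = Σ_{K+2s=M} q^(2j(K+3s)) g(s,K) h(K), with A_0 = ã, they yield two relations:
-- A_j - A_{j+1} is a combination of A_{j+2} and A_{j+3}, and q^(6M) A_j - A_{j+3} is a multiple
-- of A_{j+3}(M-2).  Eliminating A_1, …, A_5 from 29 instances of these relations gives the
-- recurrence; the elimination is recorded as an explicit linear combination, checked by ring
-- normalisation with integer coefficients.
module Submission where

open import Algebra.Bundles using (CommutativeRing)
open import Data.Nat as ℕ using (ℕ; zero; suc)
import Data.Nat.Properties as ℕ
open import Level using (Level)
open import Relation.Binary.PropositionalEquality as ≡ using (_≡_)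
open import Data.Nat.Combinatorics using (_C_; nCk+nC[k+1]≡[n+1]C[k+1]; nC1≡n)
open import Defs

[1+n]C2≡n+nC2 : ∀ n → suc n C 2 ≡ n ℕ.+ n C 2
[1+n]C2≡n+nC2 n = ≡.trans (≡.sym (nCk+nC[k+1]≡[n+1]C[k+1] n 1)) (≡.cong (ℕ._+ n C 2) (nC1≡n n))

module IntegerExpressions where

  open import Data.Integer using (ℤ; +_)
  open import Data.Product using (_×_; _,_)
  open import Tactic.RingSolver.Core.Expression public using (Expr; Κ; Ι; _⊕_; _⊗_; ⊝_; _⊛_)

  infixl 6 _:+_ _:-_
  infixl 7 _:*_
  infixr 8 _:^_
  infix 4 _⊜_

  _⊜_ : ∀ {n} → Expr ℤ n → Expr ℤ n → Expr ℤ n × Expr ℤ n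
  _⊜_ = _,_

  _:+_ _:*_ _:-_ : ∀ {n} → Expr ℤ n → Expr ℤ n → Expr ℤ n
  x :+ y = x ⊕ y
  x :* y = x ⊗ y
  x :- y = x ⊕ ⊝ y

  :0 :1 : ∀ {n} → Expr ℤ n
  :0 = Κ (+ 0)
  :1 = Κ (+ 1)

  _:^_ : ∀ {n} → Expr ℤ n → ℕ → Expr ℤ n
  x :^ zero = :1
  x :^ suc n = x :* x :^ n

-- Tactic.RingSolver.NonReflective uses the carrier as its own coefficient ring, so in an abstract
-- ring it cannot cancel numerals such as 1 + (- 1); this instantiates the same machinery with
-- integer coefficients.
module IntegerRingSolver {c ℓ} (R : CommutativeRing c ℓ) where

  open import Data.Bool using (Bool; true; false; T)
  open import Data.Integer as ℤ using (ℤ; +_; -[1+_])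
  import Data.Integer.Properties as ℤ
  open import Data.Maybe using (nothing)
  open import Data.Sign as Sign using (Sign)
  open import Data.Vec using (Vec)

  open CommutativeRing R
  open import Algebra.Properties.Ring ring using (-‿involutive; -‿distribˡ-*; -0#≈0#)
  open import Algebra.Properties.AbelianGroup +-abelianGroup using (⁻¹-∙-comm)
  open import Algebra.Properties.Group +-group using (x∙y⁻¹≈ε⇒x≈y; x≈y⇒x∙y⁻¹≈ε)
  open import Algebra.Properties.CommutativeSemigroup +-commutativeSemigroup using (interchange)
  open import Algebra.Properties.CommutativeSemigroup *-commutativeSemigroup
    using () renaming (interchange to *-interchange)
  open import Algebra.Properties.Semiring.Mult.TCOptimised semiring using (_×_; ×-homo-+; ×1-homo-*; 1+×)
  open import Relation.Binary.Reasoning.Setoid setoid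
  open import Tactic.RingSolver.Core.AlmostCommutativeRing using (AlmostCommutativeRing; fromCommutativeRing)
  open import Tactic.RingSolver.Core.Polynomial.Parameters using (Homomorphism)
  import Tactic.RingSolver.Core.Polynomial.Homomorphism as PolynomialHomomorphism
  import Tactic.RingSolver.Core.Polynomial.Semantics as PolynomialSemantics
  import Algebra.Properties.Semiring.Exp.TCOptimised as Exp

  ⟦_⟧ℤ : ℤ → Carrier
  ⟦ + n ⟧ℤ = n × 1#
  ⟦ -[1+ n ] ⟧ℤ = - (suc n × 1#)

  private
    sign : Sign → Carrier
    sign Sign.+ = 1#
    sign Sign.- = - 1#

    sign-* : ∀ s t → sign (s Sign.* t) ≈ sign s * sign t
    sign-* Sign.+ t = sym (*-identityˡ _)
    sign-* Sign.- Sign.+ = sym (*-identityʳ _)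
    sign-* Sign.- Sign.- = sym (trans (sym (-‿distribˡ-* _ _)) (trans (-‿cong (*-identityˡ _)) (-‿involutive _)))

    -1* : ∀ x → - x ≈ - 1# * x
    -1* x = trans (-‿cong (sym (*-identityˡ x))) (-‿distribˡ-* 1# x)

    sign-◃ : ∀ s n → ⟦ s ℤ.◃ n ⟧ℤ ≈ sign s * (n × 1#)
    sign-◃ s zero = sym (zeroʳ _)
    sign-◃ Sign.+ (suc n) = sym (*-identityˡ _)
    sign-◃ Sign.- (suc n) = -1* _

    sign-∣∣ : ∀ i → ⟦ i ⟧ℤ ≈ sign (ℤ.sign i) * (ℤ.∣ i ∣ × 1#)
    sign-∣∣ (+ n) = sym (*-identityˡ _)
    sign-∣∣ -[1+ n ] = -1* _

    ⊖-homo : ∀ m n → ⟦ m ℤ.⊖ n ⟧ℤ ≈ m × 1# - n × 1#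
    ⊖-homo zero zero = sym (trans (+-congˡ -0#≈0#) (+-identityʳ _))
    ⊖-homo zero (suc n) = sym (+-identityˡ _)
    ⊖-homo (suc m) zero = sym (trans (+-congˡ -0#≈0#) (+-identityʳ _))
    ⊖-homo (suc m) (suc n) = begin
      ⟦ suc m ℤ.⊖ suc n ⟧ℤ              ≡⟨ ≡.cong ⟦_⟧ℤ (ℤ.[1+m]⊖[1+n]≡m⊖n m n) ⟩
      ⟦ m ℤ.⊖ n ⟧ℤ                      ≈⟨ ⊖-homo m n ⟩
      m × 1# - n × 1#                   ≈⟨ +-identityˡ _ ⟨
      0# + (m × 1# - n × 1#)            ≈⟨ +-congʳ (-‿inverseʳ 1#) ⟨
      (1# - 1#) + (m × 1# - n × 1#)     ≈⟨ interchange _ _ _ _ ⟩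
      (1# + m × 1#) + (- 1# - n × 1#)   ≈⟨ +-cong (1+× m 1#) (trans (-‿cong (1+× n 1#)) (sym (⁻¹-∙-comm _ _))) ⟨
      suc m × 1# - suc n × 1#           ∎

    +-homo : ∀ i j → ⟦ i ℤ.+ j ⟧ℤ ≈ ⟦ i ⟧ℤ + ⟦ j ⟧ℤ
    +-homo (+ m) (+ n) = ×-homo-+ 1# m n
    +-homo (+ m) -[1+ n ] = ⊖-homo m (suc n)
    +-homo -[1+ m ] (+ n) = trans (⊖-homo n (suc m)) (+-comm _ _)
    +-homo -[1+ m ] -[1+ n ] = begin
      - (suc (suc (m ℕ.+ n)) × 1#)       ≡⟨ ≡.cong (λ k → - (suc k × 1#)) (ℕ.+-suc m n) ⟨
      - ((suc m ℕ.+ suc n) × 1#)         ≈⟨ -‿cong (×-homo-+ 1# (suc m) (suc n)) ⟩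
      - (suc m × 1# + suc n × 1#)        ≈⟨ ⁻¹-∙-comm _ _ ⟨
      - (suc m × 1#) - (suc n × 1#)      ∎

    *-homo : ∀ i j → ⟦ i ℤ.* j ⟧ℤ ≈ ⟦ i ⟧ℤ * ⟦ j ⟧ℤ
    *-homo i j = begin
      ⟦ ℤ.sign i Sign.* ℤ.sign j ℤ.◃ ℤ.∣ i ∣ ℕ.* ℤ.∣ j ∣ ⟧ℤ
        ≈⟨ sign-◃ (ℤ.sign i Sign.* ℤ.sign j) (ℤ.∣ i ∣ ℕ.* ℤ.∣ j ∣) ⟩
      sign (ℤ.sign i Sign.* ℤ.sign j) * ((ℤ.∣ i ∣ ℕ.* ℤ.∣ j ∣) × 1#)
        ≈⟨ *-cong (sign-* (ℤ.sign i) (ℤ.sign j)) (×1-homo-* ℤ.∣ i ∣ ℤ.∣ j ∣) ⟩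
      (sign (ℤ.sign i) * sign (ℤ.sign j)) * ((ℤ.∣ i ∣ × 1#) * (ℤ.∣ j ∣ × 1#))
        ≈⟨ *-interchange _ _ _ _ ⟩
      (sign (ℤ.sign i) * (ℤ.∣ i ∣ × 1#)) * (sign (ℤ.sign j) * (ℤ.∣ j ∣ × 1#))
        ≈⟨ *-cong (sign-∣∣ i) (sign-∣∣ j) ⟨
      ⟦ i ⟧ℤ * ⟦ j ⟧ℤ ∎

    -‿homo : ∀ i → ⟦ ℤ.- i ⟧ℤ ≈ - ⟦ i ⟧ℤ
    -‿homo (+ zero) = sym -0#≈0#
    -‿homo (+ suc n) = refl
    -‿homo -[1+ n ] = sym (-‿involutive _)

    isZero : ℤ → Bool
    isZero (+ zero) = true
    isZero _ = false

    isZero-sound : ∀ i → T (isZero i) → 0# ≈ ⟦ i ⟧ℤ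
    isZero-sound (+ zero) _ = refl

  homomorphism : Homomorphism _ _ c ℓ
  homomorphism = record
    { from = record { rawRing = ℤ.+-*-rawRing ; isZero = isZero }
    ; to = fromCommutativeRing R (λ _ → nothing)
    ; morphism = record
      { ⟦_⟧ = ⟦_⟧ℤ ; +-homo = +-homo ; *-homo = *-homo ; -‿homo = -‿homo ; 0-homo = refl ; 1-homo = refl }
    ; Zero-C⟶Zero-R = isZero-sound
    }

  open IntegerExpressions
  open import Tactic.RingSolver.Core.Expression using (module Eval)
  open Eval rawRing ⟦_⟧ℤ public
  open import Tactic.RingSolver.Core.Polynomial.Base (Homomorphism.from homomorphism)
    using (Poly; κ; ι; _⊞_; _⊠_; ⊟_; _⊡_)
  open PolynomialSemantics homomorphism using () renaming (⟦_⟧ to ⟦_⟧ₚ)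
  open PolynomialHomomorphism homomorphism using (κ-hom; ι-hom; ⊞-hom; ⊠-hom; ⊟-hom; ⊡-hom)
  open Exp (AlmostCommutativeRing.semiring (Homomorphism.to homomorphism)) using (^-congˡ)

  normalise : ∀ {n} → Expr ℤ n → Poly n
  normalise (Κ x) = κ x
  normalise (Ι x) = ι x
  normalise (x ⊕ y) = normalise x ⊞ normalise y
  normalise (x ⊗ y) = normalise x ⊠ normalise y
  normalise (⊝ x) = ⊟ normalise x
  normalise (x ⊛ i) = normalise x ⊡ i

  ⟦_⇓⟧ : ∀ {n} → Expr ℤ n → Vec Carrier n → Carrier
  ⟦ e ⇓⟧ = ⟦ normalise e ⟧ₚ

  normalise-correct : ∀ {n} (e : Expr ℤ n) ρ → ⟦ e ⇓⟧ ρ ≈ ⟦ e ⟧ ρ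
  normalise-correct (Κ x) ρ = κ-hom x ρ
  normalise-correct (Ι x) ρ = ι-hom x ρ
  normalise-correct (x ⊕ y) ρ =
    trans (⊞-hom (normalise x) (normalise y) ρ) (+-cong (normalise-correct x ρ) (normalise-correct y ρ))
  normalise-correct (x ⊗ y) ρ =
    trans (⊠-hom (normalise x) (normalise y) ρ) (*-cong (normalise-correct x ρ) (normalise-correct y ρ))
  normalise-correct (⊝ x) ρ = trans (⊟-hom (normalise x) ρ) (-‿cong (normalise-correct x ρ))
  normalise-correct (x ⊛ i) ρ = trans (⊡-hom (normalise x) i ρ) (^-congˡ i (normalise-correct x ρ))

  open import Relation.Binary.Reflection setoid Ι ⟦_⟧ ⟦_⇓⟧ normalise-correct public using (prove; solve)

  ≈-by-combination : ∀ {l r s} → l - r ≈ s → s ≈ 0# → l ≈ r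
  ≈-by-combination l-r≈s s≈0 = x∙y⁻¹≈ε⇒x≈y _ _ (trans l-r≈s s≈0)

  *⊖-cancel : ∀ {c l r} → l ≈ r → c * (l - r) ≈ 0#
  *⊖-cancel {c} l≈r = trans (*-congˡ (x≈y⇒x∙y⁻¹≈ε l≈r)) (zeroʳ c)

  infixl 5 _+₀_
  _+₀_ : ∀ {a b} → a ≈ 0# → b ≈ 0# → a + b ≈ 0#
  a≈0 +₀ b≈0 = trans (+-cong a≈0 b≈0) (+-identityʳ 0#)

module FiniteSums {c ℓ} (R : CommutativeRing c ℓ) where

  open import Data.Bool using (if_then_else_)
  open import Data.Empty using (⊥-elim)
  open import Data.Nat using (_<_; s≤s)
  open import Data.Nat.Tactic.RingSolver using (solve-∀)
  open import Relation.Nullary using (¬_; Dec; yes; no)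
  open import Relation.Nullary.Decidable using (⌊_⌋)

  open CommutativeRing R
  open QDefs R
  open import Algebra.Properties.AbelianGroup +-abelianGroup using (⁻¹-∙-comm)
  open import Algebra.Properties.CommutativeSemigroup +-commutativeSemigroup using (interchange)
  open import Relation.Binary.Reasoning.Setoid setoid

  sumTo-cong : ∀ n {f g : ℕ → Carrier} → (∀ i → f i ≈ g i) → sumTo n f ≈ sumTo n g
  sumTo-cong zero f≈g = refl
  sumTo-cong (suc n) f≈g = +-cong (sumTo-cong n f≈g) (f≈g n)

  sumTo-+ : ∀ n (f g : ℕ → Carrier) → sumTo n (λ i → f i + g i) ≈ sumTo n f + sumTo n g
  sumTo-+ zero f g = sym (+-identityʳ 0#)
  sumTo-+ (suc n) f g = trans (+-congʳ (sumTo-+ n f g)) (interchange _ _ _ _)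

  sumTo-zero : ∀ n {f : ℕ → Carrier} → (∀ i → f i ≈ 0#) → sumTo n f ≈ 0#
  sumTo-zero zero f≈0 = refl
  sumTo-zero (suc n) f≈0 = trans (+-cong (sumTo-zero n f≈0) (f≈0 n)) (+-identityʳ 0#)

  sumTo-head : ∀ n (f : ℕ → Carrier) → sumTo (suc n) f ≈ f 0 + sumTo n (λ i → f (suc i))
  sumTo-head zero f = trans (+-identityˡ _) (sym (+-identityʳ _))
  sumTo-head (suc n) f = trans (+-congʳ (sumTo-head n f)) (+-assoc _ _ _)

  sumTo-swap : ∀ m n (f : ℕ → ℕ → Carrier) →
    sumTo m (λ i → sumTo n (f i)) ≈ sumTo n (λ j → sumTo m (λ i → f i j))
  sumTo-swap zero n f = sym (sumTo-zero n (λ _ → refl))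
  sumTo-swap (suc m) n f = begin
    sumTo m (λ i → sumTo n (f i)) + sumTo n (f m)               ≈⟨ +-congʳ (sumTo-swap m n f) ⟩
    sumTo n (λ j → sumTo m (λ i → f i j)) + sumTo n (f m)       ≈⟨ sumTo-+ n _ _ ⟨
    sumTo n (λ j → sumTo m (λ i → f i j) + f m j)               ∎

  -- Opaque so that δ m n x stays rigid and m, n can be inferred from goals.
  opaque
    δ : ℕ → ℕ → Carrier → Carrier
    δ m n x = if ⌊ m ℕ.≟ n ⌋ then x else 0#

    δ-unfold : ∀ m n x → (if ⌊ m ℕ.≟ n ⌋ then x else 0#) ≈ δ m n x
    δ-unfold m n x = refl

    δ-≡ : ∀ {m n} x → m ≡ n → δ m n x ≈ x
    δ-≡ {m} {n} x m≡n with m ℕ.≟ n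
    ... | yes _ = refl
    ... | no m≢n = ⊥-elim (m≢n m≡n)

    δ-≢ : ∀ {m n} x → ¬ m ≡ n → δ m n x ≈ 0#
    δ-≢ {m} {n} x m≢n with m ℕ.≟ n
    ... | yes m≡n = ⊥-elim (m≢n m≡n)
    ... | no _ = refl

  δ-suc : ∀ m n x → δ (suc m) (suc n) x ≈ δ m n x
  δ-suc m n x = by (m ℕ.≟ n)
    where
    by : Dec (m ≡ n) → δ (suc m) (suc n) x ≈ δ m n x
    by (yes m≡n) = trans (δ-≡ x (≡.cong suc m≡n)) (sym (δ-≡ x m≡n))
    by (no m≢n) = trans (δ-≢ x (λ e → m≢n (ℕ.suc-injective e))) (sym (δ-≢ x m≢n))

  δ-cong : ∀ {m m′} n x → m ≡ m′ → δ m n x ≈ δ m′ n x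
  δ-cong n x ≡.refl = refl

  sumTo-δ : ∀ B K (g : ℕ → Carrier) → K < B → sumTo B (λ b → δ b K (g b)) ≈ g K
  sumTo-δ (suc B) zero g _ = begin
    sumTo (suc B) (λ b → δ b 0 (g b))        ≈⟨ sumTo-head B _ ⟩
    δ 0 0 (g 0) + sumTo B (λ b → δ (suc b) 0 (g (suc b)))
      ≈⟨ +-cong (δ-≡ (g 0) ≡.refl) (sumTo-zero B (λ b → δ-≢ (g (suc b)) (λ ()))) ⟩
    g 0 + 0#                                 ≈⟨ +-identityʳ (g 0) ⟩
    g 0                                      ∎
  sumTo-δ (suc B) (suc K) g (s≤s K<B) = begin
    sumTo (suc B) (λ b → δ b (suc K) (g b))  ≈⟨ sumTo-head B _ ⟩
    δ 0 (suc K) (g 0) + sumTo B (λ b → δ (suc b) (suc K) (g (suc b)))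
      ≈⟨ +-cong (δ-≢ (g 0) (λ ())) (sumTo-cong B (λ b → δ-suc b K (g (suc b)))) ⟩
    0# + sumTo B (λ b → δ b K (g (suc b)))   ≈⟨ +-identityˡ _ ⟩
    sumTo B (λ b → δ b K (g (suc b)))        ≈⟨ sumTo-δ B K (λ b → g (suc b)) K<B ⟩
    g (suc K)                                ∎

  Σ₊ : ℕ → (ℕ → ℕ → Carrier) → Carrier
  Σ₊ zero f = f 0 0
  Σ₊ (suc K) f = f 0 (suc K) + Σ₊ K (λ a b → f (suc a) b)

  Σ₊₂ : ℕ → (ℕ → ℕ → Carrier) → Carrier
  Σ₊₂ zero f = f 0 0
  Σ₊₂ (suc zero) f = f 0 1
  Σ₊₂ (suc (suc M)) f = f 0 (suc (suc M)) + Σ₊₂ M (λ s K → f (suc s) K)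

  sumTo²-δ : ∀ K B₁ B₂ (f : ℕ → ℕ → Carrier) → K < B₁ → K < B₂ →
    sumTo B₁ (λ a → sumTo B₂ (λ b → δ (a ℕ.+ b) K (f a b))) ≈ Σ₊ K f
  sumTo²-δ zero (suc B₁) B₂ f _ 0<B₂ = begin
    _   ≈⟨ sumTo-head B₁ _ ⟩
    _   ≈⟨ +-cong (sumTo-δ B₂ 0 (f 0) 0<B₂)
                  (sumTo-zero B₁ (λ a → sumTo-zero B₂ (λ b → δ-≢ _ (λ ())))) ⟩
    f 0 0 + 0#  ≈⟨ +-identityʳ _ ⟩
    f 0 0       ∎
  sumTo²-δ (suc K) (suc B₁) B₂ f (s≤s K<B₁) K<B₂ = begin
    _   ≈⟨ sumTo-head B₁ _ ⟩
    _   ≈⟨ +-cong (sumTo-δ B₂ (suc K) (f 0) K<B₂)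
                  (trans (sumTo-cong B₁ (λ a → sumTo-cong B₂ (λ b → δ-suc (a ℕ.+ b) K _)))
                         (sumTo²-δ K B₁ B₂ (λ a b → f (suc a) b) K<B₁ (ℕ.<-trans (ℕ.n<1+n K) K<B₂))) ⟩
    Σ₊ (suc K) f ∎

  private
    +2*suc : ∀ a b s → a ℕ.+ b ℕ.+ 2 ℕ.* suc s ≡ suc (suc (a ℕ.+ b ℕ.+ 2 ℕ.* s))
    +2*suc = solve-∀

    +2*zero : ∀ a b → a ℕ.+ b ℕ.+ 2 ℕ.* 0 ≡ a ℕ.+ b
    +2*zero = solve-∀

    sumTo³-head : ∀ M B₁ B₂ B₃ (F : ℕ → ℕ → ℕ → Carrier) → M < B₁ → M < B₂ →
      sumTo (suc B₃) (λ s → sumTo B₁ (λ a → sumTo B₂ (λ b → δ (a ℕ.+ b ℕ.+ 2 ℕ.* s) M (F a b s))))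
        ≈ Σ₊ M (λ a b → F a b 0)
          + sumTo B₃ (λ s → sumTo B₁ (λ a → sumTo B₂ (λ b →
              δ (suc (suc (a ℕ.+ b ℕ.+ 2 ℕ.* s))) M (F a b (suc s)))))
    sumTo³-head M B₁ B₂ B₃ F M<B₁ M<B₂ = trans (sumTo-head B₃ _) (+-cong
      (trans (sumTo-cong B₁ (λ a → sumTo-cong B₂ (λ b → δ-cong M _ (+2*zero a b))))
             (sumTo²-δ M B₁ B₂ _ M<B₁ M<B₂))
      (sumTo-cong B₃ (λ s → sumTo-cong B₁ (λ a → sumTo-cong B₂ (λ b → δ-cong M _ (+2*suc a b s))))))

  sumTo³-δ : ∀ M B₁ B₂ B₃ (F : ℕ → ℕ → ℕ → Carrier) → M < B₁ → M < B₂ → M < B₃ →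
    sumTo B₃ (λ s → sumTo B₁ (λ a → sumTo B₂ (λ b → δ (a ℕ.+ b ℕ.+ 2 ℕ.* s) M (F a b s))))
      ≈ Σ₊₂ M (λ s K → Σ₊ K (λ a b → F a b s))
  sumTo³-δ zero B₁ B₂ (suc B₃) F M<B₁ M<B₂ _ = trans (sumTo³-head 0 B₁ B₂ B₃ F M<B₁ M<B₂)
    (trans (+-congˡ (sumTo-zero B₃ (λ s → sumTo-zero B₁ (λ a → sumTo-zero B₂ (λ b → δ-≢ _ (λ ()))))))
           (+-identityʳ _))
  sumTo³-δ (suc zero) B₁ B₂ (suc B₃) F M<B₁ M<B₂ _ = trans (sumTo³-head 1 B₁ B₂ B₃ F M<B₁ M<B₂)
    (trans (+-congˡ (sumTo-zero B₃ (λ s → sumTo-zero B₁ (λ a → sumTo-zero B₂ (λ b →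
              trans (δ-suc _ 0 _) (δ-≢ _ (λ ())))))))
           (+-identityʳ _))
  sumTo³-δ (suc (suc M)) B₁ B₂ (suc B₃) F M<B₁ M<B₂ (s≤s (s≤s M<B₃)) =
    trans (sumTo³-head (suc (suc M)) B₁ B₂ B₃ F M<B₁ M<B₂) (+-congˡ (trans
      (sumTo-cong B₃ (λ s → sumTo-cong B₁ (λ a → sumTo-cong B₂ (λ b →
        trans (δ-suc _ _ _) (δ-suc _ _ _)))))
      (sumTo³-δ M B₁ B₂ B₃ (λ a b s → F a b (suc s)) (<-weaken M<B₁) (<-weaken M<B₂) (ℕ.m<n⇒m<1+n M<B₃))))
    where
    <-weaken : ∀ {B} → suc (suc M) < B → M < B
    <-weaken = ℕ.<-trans (ℕ.<-trans (ℕ.n<1+n M) (ℕ.n<1+n (suc M)))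

  Σ₊-cong : ∀ K {f g : ℕ → ℕ → Carrier} → (∀ a b → f a b ≈ g a b) → Σ₊ K f ≈ Σ₊ K g
  Σ₊-cong zero f≈g = f≈g 0 0
  Σ₊-cong (suc K) f≈g = +-cong (f≈g 0 (suc K)) (Σ₊-cong K (λ a b → f≈g (suc a) b))

  Σ₊-+ : ∀ K (f g : ℕ → ℕ → Carrier) → Σ₊ K (λ a b → f a b + g a b) ≈ Σ₊ K f + Σ₊ K g
  Σ₊-+ zero f g = refl
  Σ₊-+ (suc K) f g = trans (+-congˡ (Σ₊-+ K _ _)) (interchange _ _ _ _)

  Σ₊-neg : ∀ K (f : ℕ → ℕ → Carrier) → Σ₊ K (λ a b → - f a b) ≈ - Σ₊ K f
  Σ₊-neg zero f = refl
  Σ₊-neg (suc K) f = trans (+-congˡ (Σ₊-neg K _)) (⁻¹-∙-comm _ _)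

  Σ₊-⊖ : ∀ K (f g : ℕ → ℕ → Carrier) → Σ₊ K (λ a b → f a b ⊖ g a b) ≈ Σ₊ K f ⊖ Σ₊ K g
  Σ₊-⊖ K f g = trans (Σ₊-+ K f _) (+-congˡ (Σ₊-neg K g))

  Σ₊-factor : ∀ K (c : ℕ → Carrier) (f : ℕ → ℕ → Carrier) →
    Σ₊ K (λ a b → c (a ℕ.+ b) * f a b) ≈ c K * Σ₊ K f
  Σ₊-factor zero c f = refl
  Σ₊-factor (suc K) c f = trans (+-congˡ (Σ₊-factor K (λ n → c (suc n)) _)) (sym (distribˡ _ _ _))

  Σ₊-shiftʳ : ∀ K (f : ℕ → ℕ → Carrier) → (∀ a → f a 0 ≈ 0#) →
    Σ₊ (suc K) f ≈ Σ₊ K (λ a b → f a (suc b))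
  Σ₊-shiftʳ zero f f·0≈0 = trans (+-congˡ (f·0≈0 1)) (+-identityʳ _)
  Σ₊-shiftʳ (suc K) f f·0≈0 = +-congˡ (Σ₊-shiftʳ K (λ a b → f (suc a) b) (λ a → f·0≈0 (suc a)))

  Σ₊₂-cong : ∀ M {f g : ℕ → ℕ → Carrier} → (∀ s K → f s K ≈ g s K) → Σ₊₂ M f ≈ Σ₊₂ M g
  Σ₊₂-cong zero f≈g = f≈g 0 0
  Σ₊₂-cong (suc zero) f≈g = f≈g 0 1
  Σ₊₂-cong (suc (suc M)) f≈g = +-cong (f≈g 0 _) (Σ₊₂-cong M (λ s K → f≈g (suc s) K))

  Σ₊₂-+ : ∀ M (f g : ℕ → ℕ → Carrier) → Σ₊₂ M (λ s K → f s K + g s K) ≈ Σ₊₂ M f + Σ₊₂ M g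
  Σ₊₂-+ zero f g = refl
  Σ₊₂-+ (suc zero) f g = refl
  Σ₊₂-+ (suc (suc M)) f g = trans (+-congˡ (Σ₊₂-+ M _ _)) (interchange _ _ _ _)

  Σ₊₂-* : ∀ M x (f : ℕ → ℕ → Carrier) → Σ₊₂ M (λ s K → x * f s K) ≈ x * Σ₊₂ M f
  Σ₊₂-* zero x f = refl
  Σ₊₂-* (suc zero) x f = refl
  Σ₊₂-* (suc (suc M)) x f = trans (+-congˡ (Σ₊₂-* M x _)) (sym (distribˡ _ _ _))

  Σ₊₂-neg : ∀ M (f : ℕ → ℕ → Carrier) → Σ₊₂ M (λ s K → - f s K) ≈ - Σ₊₂ M f
  Σ₊₂-neg zero f = refl
  Σ₊₂-neg (suc zero) f = refl
  Σ₊₂-neg (suc (suc M)) f = trans (+-congˡ (Σ₊₂-neg M _)) (⁻¹-∙-comm _ _)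

  Σ₊₂-⊖ : ∀ M (f g : ℕ → ℕ → Carrier) → Σ₊₂ M (λ s K → f s K ⊖ g s K) ≈ Σ₊₂ M f ⊖ Σ₊₂ M g
  Σ₊₂-⊖ M f g = trans (Σ₊₂-+ M f _) (+-congˡ (Σ₊₂-neg M g))

  Σ₊₂-shiftᴷ : ∀ M (f : ℕ → ℕ → Carrier) → (∀ s → f s 0 ≈ 0#) →
    Σ₊₂ (suc M) f ≈ Σ₊₂ M (λ s K → f s (suc K))
  Σ₊₂-shiftᴷ zero f f·0≈0 = refl
  Σ₊₂-shiftᴷ (suc zero) f f·0≈0 = trans (+-congˡ (f·0≈0 1)) (+-identityʳ _)
  Σ₊₂-shiftᴷ (suc (suc M)) f f·0≈0 = +-congˡ (Σ₊₂-shiftᴷ M _ (λ s → f·0≈0 (suc s)))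

  Σ₊₂-shiftˢ : ∀ M (f : ℕ → ℕ → Carrier) → (∀ K → f 0 K ≈ 0#) →
    Σ₊₂ (suc (suc M)) f ≈ Σ₊₂ M (λ s K → f (suc s) K)
  Σ₊₂-shiftˢ M f f0·≈0 = trans (+-congʳ (f0·≈0 _)) (+-identityˡ _)

  Σ₊₂-restrict : ∀ M (f : ℕ → ℕ → ℕ → Carrier) →
    Σ₊₂ M (λ s K → f (K ℕ.+ 2 ℕ.* s) s K) ≈ Σ₊₂ M (f M)
  Σ₊₂-restrict zero f = refl
  Σ₊₂-restrict (suc zero) f = refl
  Σ₊₂-restrict (suc (suc M)) f = +-cong
    (reflexive (≡.cong (λ m → f m 0 (suc (suc M))) (ℕ.+-identityʳ (suc (suc M)))))
    (trans (Σ₊₂-cong M (λ s K → reflexive (≡.cong (λ m → f m (suc s) K) (+2*suc′ K s))))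
           (Σ₊₂-restrict M (λ m s K → f (suc (suc m)) (suc s) K)))
    where
    +2*suc′ : ∀ K s → K ℕ.+ 2 ℕ.* suc s ≡ suc (suc (K ℕ.+ 2 ℕ.* s))
    +2*suc′ = solve-∀

module Powers {c ℓ} (R : CommutativeRing c ℓ) where

  open CommutativeRing R
  open QDefs R

  ^-+ : ∀ x m n → x ^ (m ℕ.+ n) ≈ x ^ m * x ^ n
  ^-+ x zero n = sym (*-identityˡ _)
  ^-+ x (suc m) n = trans (*-congˡ (^-+ x m n)) (sym (*-assoc _ _ _))

  [1-x⁰]*y≈0 : ∀ x y → (1# ⊖ x ^ 0) * y ≈ 0#
  [1-x⁰]*y≈0 x y = trans (*-congʳ (-‿inverseʳ 1#)) (zeroˡ y)

  ^-split : ∀ x m a b → m ≡ a ℕ.+ b → x ^ m ≈ x ^ a * x ^ b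
  ^-split x _ a b ≡.refl = ^-+ x a b

  ^-regroup : ∀ x a b c d → a ℕ.+ b ≡ c ℕ.+ d → x ^ a * x ^ b ≈ x ^ c * x ^ d
  ^-regroup x a b c d eq = trans (sym (^-+ x a b)) (^-split x _ c d eq)

  ^-regroup₄ : ∀ x a b c d e f → a ℕ.+ (b ℕ.+ (c ℕ.+ d)) ≡ e ℕ.+ f →
    x ^ a * (x ^ b * (x ^ c * x ^ d)) ≈ x ^ e * x ^ f
  ^-regroup₄ x a b c d e f eq =
    trans (*-congˡ (trans (*-congˡ (sym (^-+ x c d))) (sym (^-+ x b _)))) (^-regroup x a _ e f eq)

  ^-regroup₅ : ∀ x a b c d e f g → a ℕ.+ (b ℕ.+ (c ℕ.+ (d ℕ.+ e))) ≡ f ℕ.+ g →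
    x ^ a * (x ^ b * (x ^ c * (x ^ d * x ^ e))) ≈ x ^ f * x ^ g
  ^-regroup₅ x a b c d e f g eq = trans (*-congˡ (*-congˡ (*-congˡ (sym (^-+ x d e))))) (^-regroup₄ x a b c _ f g eq)

module Recurrences {c ℓ} (R : CommutativeRing c ℓ) where

  open import Data.List using (_∷_; [])
  open import Data.Nat.Tactic.RingSolver using (solve-∀) renaming (solve to solveℕ)

  open CommutativeRing R
  open QDefs R
  open FiniteSums R
  open Powers R
  open IntegerExpressions
  open IntegerRingSolver R
  open import Algebra.Properties.Group +-group using (x≈y⇒x∙y⁻¹≈ε)
  open import Algebra.Properties.Ring ring using (-0#≈0#)
  open import Relation.Binary.Reasoning.Setoid setoid

  module Sequences (q y : Carrier) (inv : ℕ → Carrier)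
                   (inv-inverse : ∀ m → (1# ⊖ q ^ suc m) * inv m ≈ 1#) where

    pochInv-step : ∀ a n →
      (1# ⊖ q ^ (suc a ℕ.* suc n)) * pochInv inv (suc a) (suc n) ≈ pochInv inv (suc a) n
    pochInv-step a n = trans (solve 3 (λ z p i → z :* (p :* i) ⊜ p :* (z :* i)) refl _ _ _)
                             (trans (*-congˡ (inv-inverse _)) (*-identityʳ _))

    hExp : ℕ → ℕ → ℕ
    hExp a b = 4 ℕ.* (a C 2) ℕ.+ 4 ℕ.* (b C 2) ℕ.+ 2 ℕ.* a ℕ.* b ℕ.+ a ℕ.+ 2 ℕ.* b

    gExp : ℕ → ℕ → ℕ
    gExp s K = 18 ℕ.* (s C 2) ℕ.+ 9 ℕ.* s ℕ.+ 6 ℕ.* s ℕ.* K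

    hTerm : ℕ → ℕ → Carrier
    hTerm a b = y ^ b * q ^ hExp a b * pochInv inv 2 a * pochInv inv 2 b

    g : ℕ → ℕ → Carrier
    g s K = (- 1#) ^ s * y ^ s * q ^ gExp s K * pochInv inv 6 s

    h h⁺ : ℕ → Carrier
    h K = Σ₊ K hTerm
    h⁺ K = Σ₊ K (λ a b → q ^ (2 ℕ.* a) * hTerm a b)

    W : ℕ → ℕ → ℕ → Carrier
    W j s K = q ^ (2 ℕ.* j ℕ.* (K ℕ.+ 3 ℕ.* s)) * g s K * h K

    A : ℕ → ℕ → Carrier
    A j M = Σ₊₂ M (W j)

    term≈g*hTerm : ∀ a b s → term q y inv a b s ≈ g s (a ℕ.+ b) * hTerm a b
    term≈g*hTerm a b s = begin
      term q y inv a b s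
        ≈⟨ *-congʳ (*-congʳ (*-congʳ (*-cong (*-congˡ (^-+ y b s))
             (^-split q _ (gExp s (a ℕ.+ b)) (hExp a b) (exponent a b s (a C 2) (b C 2) (s C 2)))))) ⟩
      (- 1#) ^ s * (y ^ b * y ^ s) * (q ^ gExp s (a ℕ.+ b) * q ^ hExp a b)
        * pochInv inv 2 a * pochInv inv 2 b * pochInv inv 6 s
        ≈⟨ solve 8 (λ m yb ys qg qh pa pb ps →
             m :* (yb :* ys) :* (qg :* qh) :* pa :* pb :* ps ⊜ (m :* ys :* qg :* ps) :* (yb :* qh :* pa :* pb))
             refl _ _ _ _ _ _ _ _ ⟩
      g s (a ℕ.+ b) * hTerm a b ∎
      where
      exponent : ∀ a b s ca cb cs →
        4 ℕ.* ca ℕ.+ 4 ℕ.* cb ℕ.+ 18 ℕ.* cs ℕ.+ 2 ℕ.* a ℕ.* b ℕ.+ 6 ℕ.* b ℕ.* s ℕ.+ 6 ℕ.* s ℕ.* a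
          ℕ.+ a ℕ.+ 2 ℕ.* b ℕ.+ 9 ℕ.* s
        ≡ (18 ℕ.* cs ℕ.+ 9 ℕ.* s ℕ.+ 6 ℕ.* s ℕ.* (a ℕ.+ b))
          ℕ.+ (4 ℕ.* ca ℕ.+ 4 ℕ.* cb ℕ.+ 2 ℕ.* a ℕ.* b ℕ.+ a ℕ.+ 2 ℕ.* b)
      exponent = solve-∀

    ã≈A₀ : ∀ M → ã q y inv M ≈ A 0 M
    ã≈A₀ M = begin
      ã q y inv M
        ≈⟨ sumTo-cong (suc M) (λ _ → sumTo-cong (suc M) (λ _ → sumTo-cong (suc M) (λ _ → δ-unfold _ M _))) ⟩
      sumTo (suc M) (λ a → sumTo (suc M) (λ b → sumTo (suc M) (λ s → δ (a ℕ.+ b ℕ.+ 2 ℕ.* s) M (term q y inv a b s))))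
        ≈⟨ trans (sumTo-cong (suc M) (λ _ → sumTo-swap (suc M) (suc M) _)) (sumTo-swap (suc M) (suc M) _) ⟩
      sumTo (suc M) (λ s → sumTo (suc M) (λ a → sumTo (suc M) (λ b → δ (a ℕ.+ b ℕ.+ 2 ℕ.* s) M (term q y inv a b s))))
        ≈⟨ sumTo³-δ M (suc M) (suc M) (suc M) (term q y inv) (ℕ.n<1+n M) (ℕ.n<1+n M) (ℕ.n<1+n M) ⟩
      Σ₊₂ M (λ s K → Σ₊ K (λ a b → term q y inv a b s))
        ≈⟨ Σ₊₂-cong M (λ s K → trans (Σ₊-cong K (λ a b → term≈g*hTerm a b s)) (Σ₊-factor K (g s) hTerm)) ⟩
      Σ₊₂ M (λ s K → g s K * h K)
        ≈⟨ Σ₊₂-cong M (λ s K → trans (sym (*-identityˡ _)) (sym (*-assoc _ _ _))) ⟩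
      A 0 M ∎

    hTerm-stepᵃ : ∀ a b →
      (1# ⊖ q ^ (2 ℕ.* suc a)) * hTerm (suc a) b ≈ q ^ (4 ℕ.* a ℕ.+ 2 ℕ.* b ℕ.+ 1) * hTerm a b
    hTerm-stepᵃ a b = begin
      (1# ⊖ Z) * (y ^ b * q ^ hExp (suc a) b * pochInv inv 2 (suc a) * pochInv inv 2 b)
        ≈⟨ *-congˡ (*-congʳ (*-congʳ (*-congˡ (^-split q _ (hExp a b) _ hExp-suc)))) ⟩
      (1# ⊖ Z) * (y ^ b * (q ^ hExp a b * D) * pochInv inv 2 (suc a) * pochInv inv 2 b)
        ≈⟨ solve 6 (λ z yb qe d p′ pb → (:1 :- z) :* (yb :* (qe :* d) :* p′ :* pb) ⊜ d :* (yb :* qe :* ((:1 :- z) :* p′) :* pb))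
             refl Z _ _ D _ _ ⟩
      D * (y ^ b * q ^ hExp a b * ((1# ⊖ Z) * pochInv inv 2 (suc a)) * pochInv inv 2 b)
        ≈⟨ *-congˡ (*-congʳ (*-congˡ (pochInv-step 1 a))) ⟩
      D * hTerm a b ∎
      where
      Z = q ^ (2 ℕ.* suc a)
      D = q ^ (4 ℕ.* a ℕ.+ 2 ℕ.* b ℕ.+ 1)
      hExp-suc : hExp (suc a) b ≡ hExp a b ℕ.+ (4 ℕ.* a ℕ.+ 2 ℕ.* b ℕ.+ 1)
      hExp-suc = ≡.trans
        (≡.cong (λ t → 4 ℕ.* t ℕ.+ 4 ℕ.* (b C 2) ℕ.+ 2 ℕ.* suc a ℕ.* b ℕ.+ suc a ℕ.+ 2 ℕ.* b) ([1+n]C2≡n+nC2 a))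
        (identity a b (a C 2) (b C 2))
        where
        identity : ∀ a b ca cb →
          4 ℕ.* (a ℕ.+ ca) ℕ.+ 4 ℕ.* cb ℕ.+ 2 ℕ.* suc a ℕ.* b ℕ.+ suc a ℕ.+ 2 ℕ.* b
          ≡ (4 ℕ.* ca ℕ.+ 4 ℕ.* cb ℕ.+ 2 ℕ.* a ℕ.* b ℕ.+ a ℕ.+ 2 ℕ.* b) ℕ.+ (4 ℕ.* a ℕ.+ 2 ℕ.* b ℕ.+ 1)
        identity = solve-∀

    hTerm-stepᵇ : ∀ a b →
      (1# ⊖ q ^ (2 ℕ.* suc b)) * hTerm a (suc b) ≈ y * q ^ (4 ℕ.* b ℕ.+ 2 ℕ.* a ℕ.+ 2) * hTerm a b
    hTerm-stepᵇ a b = begin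
      (1# ⊖ Z) * (y * y ^ b * q ^ hExp a (suc b) * pochInv inv 2 a * pochInv inv 2 (suc b))
        ≈⟨ *-congˡ (*-congʳ (*-congʳ (*-congˡ (^-split q _ (hExp a b) _ hExp-suc)))) ⟩
      (1# ⊖ Z) * (y * y ^ b * (q ^ hExp a b * D) * pochInv inv 2 a * pochInv inv 2 (suc b))
        ≈⟨ solve 7 (λ z y′ yb qe d pa p′ →
             (:1 :- z) :* (y′ :* yb :* (qe :* d) :* pa :* p′) ⊜ y′ :* d :* (yb :* qe :* pa :* ((:1 :- z) :* p′)))
             refl Z y _ _ D _ _ ⟩
      y * D * (y ^ b * q ^ hExp a b * pochInv inv 2 a * ((1# ⊖ Z) * pochInv inv 2 (suc b)))
        ≈⟨ *-congˡ (*-congˡ (pochInv-step 1 b)) ⟩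
      y * D * hTerm a b ∎
      where
      Z = q ^ (2 ℕ.* suc b)
      D = q ^ (4 ℕ.* b ℕ.+ 2 ℕ.* a ℕ.+ 2)
      hExp-suc : hExp a (suc b) ≡ hExp a b ℕ.+ (4 ℕ.* b ℕ.+ 2 ℕ.* a ℕ.+ 2)
      hExp-suc = ≡.trans
        (≡.cong (λ t → 4 ℕ.* (a C 2) ℕ.+ 4 ℕ.* t ℕ.+ 2 ℕ.* a ℕ.* suc b ℕ.+ a ℕ.+ 2 ℕ.* suc b) ([1+n]C2≡n+nC2 b))
        (identity a b (a C 2) (b C 2))
        where
        identity : ∀ a b ca cb →
          4 ℕ.* ca ℕ.+ 4 ℕ.* (b ℕ.+ cb) ℕ.+ 2 ℕ.* a ℕ.* suc b ℕ.+ a ℕ.+ 2 ℕ.* suc b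
          ≡ (4 ℕ.* ca ℕ.+ 4 ℕ.* cb ℕ.+ 2 ℕ.* a ℕ.* b ℕ.+ a ℕ.+ 2 ℕ.* b) ℕ.+ (4 ℕ.* b ℕ.+ 2 ℕ.* a ℕ.+ 2)
        identity = solve-∀

    h-h⁺ : ∀ K → h (suc K) ⊖ h⁺ (suc K) ≈ q ^ (2 ℕ.* K ℕ.+ 1) * h⁺ K
    h-h⁺ K = begin
      h (suc K) ⊖ h⁺ (suc K)
        ≈⟨ Σ₊-⊖ (suc K) hTerm (λ a b → q ^ (2 ℕ.* a) * hTerm a b) ⟨
      Σ₊ (suc K) (λ a b → hTerm a b ⊖ q ^ (2 ℕ.* a) * hTerm a b)
        ≈⟨ Σ₊-cong (suc K) (λ a b → solve 2 (λ x z → x :- z :* x ⊜ (:1 :- z) :* x) refl (hTerm a b) (q ^ (2 ℕ.* a))) ⟩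
      Σ₊ (suc K) (λ a b → (1# ⊖ q ^ (2 ℕ.* a)) * hTerm a b)
        ≈⟨ trans (+-congʳ ([1-x⁰]*y≈0 q _)) (+-identityˡ _) ⟩
      Σ₊ K (λ a b → (1# ⊖ q ^ (2 ℕ.* suc a)) * hTerm (suc a) b)
        ≈⟨ Σ₊-cong K hTerm-stepᵃ ⟩
      Σ₊ K (λ a b → q ^ (4 ℕ.* a ℕ.+ 2 ℕ.* b ℕ.+ 1) * hTerm a b)
        ≈⟨ Σ₊-cong K (λ a b → trans
             (*-congʳ (^-split q (4 ℕ.* a ℕ.+ 2 ℕ.* b ℕ.+ 1) (2 ℕ.* (a ℕ.+ b) ℕ.+ 1) (2 ℕ.* a) (solveℕ (a ∷ b ∷ []))))
             (*-assoc _ _ _)) ⟩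
      Σ₊ K (λ a b → q ^ (2 ℕ.* (a ℕ.+ b) ℕ.+ 1) * (q ^ (2 ℕ.* a) * hTerm a b))
        ≈⟨ Σ₊-factor K (λ n → q ^ (2 ℕ.* n ℕ.+ 1)) _ ⟩
      q ^ (2 ℕ.* K ℕ.+ 1) * h⁺ K ∎

    h⁺-h : ∀ K → h⁺ (suc K) ⊖ q ^ (2 ℕ.* suc K) * h (suc K) ≈ y * q ^ (4 ℕ.* K ℕ.+ 2) * h K
    h⁺-h K = begin
      h⁺ (suc K) ⊖ q ^ (2 ℕ.* suc K) * h (suc K)
        ≈⟨ +-congˡ (-‿cong (Σ₊-factor (suc K) (λ n → q ^ (2 ℕ.* n)) hTerm)) ⟨
      h⁺ (suc K) ⊖ Σ₊ (suc K) (λ a b → q ^ (2 ℕ.* (a ℕ.+ b)) * hTerm a b)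
        ≈⟨ Σ₊-⊖ (suc K) (λ a b → q ^ (2 ℕ.* a) * hTerm a b) (λ a b → q ^ (2 ℕ.* (a ℕ.+ b)) * hTerm a b) ⟨
      Σ₊ (suc K) (λ a b → q ^ (2 ℕ.* a) * hTerm a b ⊖ q ^ (2 ℕ.* (a ℕ.+ b)) * hTerm a b)
        ≈⟨ Σ₊-cong (suc K) (λ a b → trans
             (+-congˡ (-‿cong (*-congʳ (^-split q (2 ℕ.* (a ℕ.+ b)) (2 ℕ.* a) (2 ℕ.* b) (solveℕ (a ∷ b ∷ []))))))
             (solve 3 (λ x z t → x :* t :- (x :* z) :* t ⊜ x :* ((:1 :- z) :* t)) refl _ _ (hTerm a b))) ⟩
      Σ₊ (suc K) (λ a b → q ^ (2 ℕ.* a) * ((1# ⊖ q ^ (2 ℕ.* b)) * hTerm a b))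
        ≈⟨ Σ₊-shiftʳ K (λ a b → q ^ (2 ℕ.* a) * ((1# ⊖ q ^ (2 ℕ.* b)) * hTerm a b))
                       (λ a → trans (*-congˡ ([1-x⁰]*y≈0 q _)) (zeroʳ _)) ⟩
      Σ₊ K (λ a b → q ^ (2 ℕ.* a) * ((1# ⊖ q ^ (2 ℕ.* suc b)) * hTerm a (suc b)))
        ≈⟨ Σ₊-cong K (λ a b → *-congˡ (hTerm-stepᵇ a b)) ⟩
      Σ₊ K (λ a b → q ^ (2 ℕ.* a) * (y * q ^ (4 ℕ.* b ℕ.+ 2 ℕ.* a ℕ.+ 2) * hTerm a b))
        ≈⟨ Σ₊-cong K (λ a b → trans
             (solve 4 (λ x y′ d t → x :* (y′ :* d :* t) ⊜ (y′ :* (x :* d)) :* t) refl _ _ _ _)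
             (*-congʳ (*-congˡ (sym (^-split q (4 ℕ.* (a ℕ.+ b) ℕ.+ 2) (2 ℕ.* a) (4 ℕ.* b ℕ.+ 2 ℕ.* a ℕ.+ 2)
                                              (solveℕ (a ∷ b ∷ []))))))) ⟩
      Σ₊ K (λ a b → y * q ^ (4 ℕ.* (a ℕ.+ b) ℕ.+ 2) * hTerm a b)
        ≈⟨ Σ₊-factor K (λ n → y * q ^ (4 ℕ.* n ℕ.+ 2)) hTerm ⟩
      y * q ^ (4 ℕ.* K ℕ.+ 2) * h K ∎

    h-rec₁ : (1# ⊖ q ^ 2) * h 1 ≈ (1# + y * q) * q * h 0
    h-rec₁ = ≈-by-combination
      (solve 5 (λ h₁ u₁ h₀ q y →
          (:1 :- q :^ 2) :* h₁ :- (:1 :+ y :* q) :* q :* h₀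
        ⊜ ((h₁ :- u₁) :- q :^ 1 :* (:1 :* h₀)) :+ ((u₁ :- q :^ 2 :* h₁) :- y :* q :^ 2 :* h₀))
        refl (h 1) (h⁺ 1) (h 0) q y)
      (x≈y⇒x∙y⁻¹≈ε (h-h⁺ 0) +₀ x≈y⇒x∙y⁻¹≈ε (h⁺-h 0))

    h-rec : ∀ K → (1# ⊖ q ^ (2 ℕ.* suc (suc K))) * h (suc (suc K))
                  ≈ (1# + y * q) * q ^ (4 ℕ.* K ℕ.+ 5) * h (suc K) + y * q ^ (6 ℕ.* K ℕ.+ 5) * h K
    h-rec K = ≈-by-combination
      (solve 14 (λ h₂ h₁ h₀ u₂ u₁ Z A₅ A₆ Q₁ Q₂ Q₃ Q₄ q y →
          (:1 :- Z) :* h₂ :- ((:1 :+ y :* q) :* A₅ :* h₁ :+ y :* A₆ :* h₀)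
        ⊜ ((h₂ :- u₂) :- Q₁ :* u₁) :+ ((u₂ :- Z :* h₂) :- y :* Q₂ :* h₁)
          :+ Q₁ :* ((u₁ :- Q₃ :* h₁) :- y :* Q₄ :* h₀)
          :+ h₁ :* (Q₁ :* Q₃ :- A₅) :+ y :* h₀ :* (Q₁ :* Q₄ :- A₆) :+ y :* h₁ :* (Q₂ :- A₅ :* q :^ 1))
        refl (h (suc (suc K))) (h (suc K)) (h K) (h⁺ (suc (suc K))) (h⁺ (suc K))
          (q ^ (2 ℕ.* suc (suc K))) (q ^ (4 ℕ.* K ℕ.+ 5)) (q ^ (6 ℕ.* K ℕ.+ 5))
          (q ^ (2 ℕ.* suc K ℕ.+ 1)) (q ^ (4 ℕ.* suc K ℕ.+ 2)) (q ^ (2 ℕ.* suc K)) (q ^ (4 ℕ.* K ℕ.+ 2)) q y)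
      (x≈y⇒x∙y⁻¹≈ε (h-h⁺ (suc K)) +₀ x≈y⇒x∙y⁻¹≈ε (h⁺-h (suc K)) +₀ *⊖-cancel (h⁺-h K)
        +₀ *⊖-cancel (sym (^-split q (4 ℕ.* K ℕ.+ 5) (2 ℕ.* suc K ℕ.+ 1) (2 ℕ.* suc K) (solveℕ (K ∷ []))))
        +₀ *⊖-cancel (sym (^-split q (6 ℕ.* K ℕ.+ 5) (2 ℕ.* suc K ℕ.+ 1) (4 ℕ.* K ℕ.+ 2) (solveℕ (K ∷ []))))
        +₀ *⊖-cancel (^-split q (4 ℕ.* suc K ℕ.+ 2) (4 ℕ.* K ℕ.+ 5) 1 (solveℕ (K ∷ []))))

    g-stepᴷ : ∀ s K → g s (suc K) ≈ q ^ (6 ℕ.* s) * g s K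
    g-stepᴷ s K = trans (*-congʳ (*-congˡ (^-split q _ (gExp s K) (6 ℕ.* s) (identity (s C 2) s K))))
      (solve 5 (λ m ys qe q6 p → m :* ys :* (qe :* q6) :* p ⊜ q6 :* (m :* ys :* qe :* p)) refl _ _ _ _ _)
      where
      identity : ∀ cs s K → 18 ℕ.* cs ℕ.+ 9 ℕ.* s ℕ.+ 6 ℕ.* s ℕ.* suc K
                            ≡ (18 ℕ.* cs ℕ.+ 9 ℕ.* s ℕ.+ 6 ℕ.* s ℕ.* K) ℕ.+ 6 ℕ.* s
      identity = solve-∀

    g-stepˢ : ∀ s K →
      (1# ⊖ q ^ (6 ℕ.* suc s)) * g (suc s) K ≈ - (y * q ^ (18 ℕ.* s ℕ.+ 9 ℕ.+ 6 ℕ.* K)) * g s K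
    g-stepˢ s K = begin
      (1# ⊖ Z) * ((- 1#) * (- 1#) ^ s * (y * y ^ s) * q ^ gExp (suc s) K * pochInv inv 6 (suc s))
        ≈⟨ *-congˡ (*-congʳ (*-congˡ (^-split q _ (gExp s K) _ gExp-suc))) ⟩
      (1# ⊖ Z) * ((- 1#) * (- 1#) ^ s * (y * y ^ s) * (q ^ gExp s K * D) * pochInv inv 6 (suc s))
        ≈⟨ solve 7 (λ z m y′ ys qe d p′ →
             (:1 :- z) :* (⊝ :1 :* m :* (y′ :* ys) :* (qe :* d) :* p′) ⊜ ⊝ (y′ :* d) :* (m :* ys :* qe :* ((:1 :- z) :* p′)))
             refl Z _ y _ _ D _ ⟩
      - (y * D) * ((- 1#) ^ s * y ^ s * q ^ gExp s K * ((1# ⊖ Z) * pochInv inv 6 (suc s)))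
        ≈⟨ *-congˡ (*-congˡ (pochInv-step 5 s)) ⟩
      - (y * D) * g s K ∎
      where
      Z = q ^ (6 ℕ.* suc s)
      D = q ^ (18 ℕ.* s ℕ.+ 9 ℕ.+ 6 ℕ.* K)
      gExp-suc : gExp (suc s) K ≡ gExp s K ℕ.+ (18 ℕ.* s ℕ.+ 9 ℕ.+ 6 ℕ.* K)
      gExp-suc = ≡.trans (≡.cong (λ t → 18 ℕ.* t ℕ.+ 9 ℕ.* suc s ℕ.+ 6 ℕ.* suc s ℕ.* K) ([1+n]C2≡n+nC2 s))
                         (identity (s C 2) s K)
        where
        identity : ∀ cs s K → 18 ℕ.* (s ℕ.+ cs) ℕ.+ 9 ℕ.* suc s ℕ.+ 6 ℕ.* suc s ℕ.* K
                              ≡ (18 ℕ.* cs ℕ.+ 9 ℕ.* s ℕ.+ 6 ℕ.* s ℕ.* K) ℕ.+ (18 ℕ.* s ℕ.+ 9 ℕ.+ 6 ℕ.* K)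
        identity = solve-∀

    X₁ X₂ X₃ : ℕ → ℕ → ℕ → Carrier
    X₁ j s zero = 0#
    X₁ j s (suc K) = (1# + y * q) * q ^ (2 ℕ.* j ℕ.+ 1) * W (2 ℕ.+ j) s K
    X₂ j s zero = 0#
    X₂ j s (suc zero) = 0#
    X₂ j s (suc (suc K)) = y * q ^ (4 ℕ.* j ℕ.+ 5) * W (3 ℕ.+ j) s K
    X₃ j zero K = 0#
    X₃ j (suc s) K = y * q ^ (6 ℕ.* j ℕ.+ 9) * W (3 ℕ.+ j) s K

    ΔgW ΔhW : ℕ → ℕ → ℕ → Carrier
    ΔgW j s K = q ^ (2 ℕ.* j ℕ.* (K ℕ.+ 3 ℕ.* s)) * ((1# ⊖ q ^ (6 ℕ.* s)) * g s K) * h K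
    ΔhW j s K = q ^ (2 ℕ.* j ℕ.* (K ℕ.+ 3 ℕ.* s)) * q ^ (6 ℕ.* s) * g s K * ((1# ⊖ q ^ (2 ℕ.* K)) * h K)

    W-split : ∀ j s K → W j s K ⊖ W (suc j) s K ≈ ΔgW j s K + ΔhW j s K
    W-split j s K = trans
      (+-congˡ (-‿cong (*-congʳ (*-congʳ (trans
        (^-split q (2 ℕ.* suc j ℕ.* (K ℕ.+ 3 ℕ.* s)) (2 ℕ.* j ℕ.* (K ℕ.+ 3 ℕ.* s)) (6 ℕ.* s ℕ.+ 2 ℕ.* K) (solveℕ (j ∷ s ∷ K ∷ [])))
        (*-congˡ (^-+ q (6 ℕ.* s) (2 ℕ.* K))))))))
      (solve 5 (λ P Z₆ Z₂ G H → P :* G :* H :- P :* (Z₆ :* Z₂) :* G :* H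
                               ⊜ P :* ((:1 :- Z₆) :* G) :* H :+ P :* Z₆ :* G :* ((:1 :- Z₂) :* H))
         refl _ _ _ (g s K) (h K))

    ΔgW≈-X₃ : ∀ j s K → ΔgW j s K ≈ - X₃ j s K
    ΔgW≈-X₃ j zero K = trans (*-congʳ (trans (*-congˡ ([1-x⁰]*y≈0 q _)) (zeroʳ _)))
                            (trans (zeroˡ _) (sym (-0#≈0#)))
    ΔgW≈-X₃ j (suc s) K = ≈-by-combination
      (solve 9 (λ P Z G G′ H D Q₉ Q y → P :* ((:1 :- Z) :* G) :* H :- ⊝ (y :* Q₉ :* (Q :* G′ :* H))
          ⊜ (P :* H) :* (((:1 :- Z) :* G) :- ⊝ (y :* D) :* G′) :+ (⊝ (y :* G′ :* H)) :* ((P :* D) :- Q₉ :* Q))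
         refl (q ^ (2 ℕ.* j ℕ.* (K ℕ.+ 3 ℕ.* suc s))) (q ^ (6 ℕ.* suc s)) (g (suc s) K) (g s K) (h K)
         (q ^ (18 ℕ.* s ℕ.+ 9 ℕ.+ 6 ℕ.* K)) (q ^ (6 ℕ.* j ℕ.+ 9)) (q ^ (2 ℕ.* (3 ℕ.+ j) ℕ.* (K ℕ.+ 3 ℕ.* s))) y)
      (*⊖-cancel (g-stepˢ s K)
        +₀ *⊖-cancel (^-regroup q (2 ℕ.* j ℕ.* (K ℕ.+ 3 ℕ.* suc s)) (18 ℕ.* s ℕ.+ 9 ℕ.+ 6 ℕ.* K)
                                  (6 ℕ.* j ℕ.+ 9) (2 ℕ.* (3 ℕ.+ j) ℕ.* (K ℕ.+ 3 ℕ.* s)) (solveℕ (j ∷ s ∷ K ∷ []))))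

    ΔhW≈X₁+X₂ : ∀ j s K → ΔhW j s K ≈ X₁ j s K + X₂ j s K
    ΔhW≈X₁+X₂ j s zero =
      trans (*-congˡ ([1-x⁰]*y≈0 q _)) (trans (zeroʳ _) (sym (+-identityʳ 0#)))
    ΔhW≈X₁+X₂ j s (suc zero) = ≈-by-combination
      (solve 10 (λ P Z₆ G₁ G₀ H₁ H₀ Q₁ Q q y →
          P :* Z₆ :* G₁ :* ((:1 :- q :^ 2) :* H₁) :- ((:1 :+ y :* q) :* Q₁ :* (Q :* G₀ :* H₀) :+ :0)
        ⊜ (P :* Z₆ :* G₁) :* ((:1 :- q :^ 2) :* H₁ :- (:1 :+ y :* q) :* q :* H₀)
          :+ (P :* Z₆ :* ((:1 :+ y :* q) :* q :* H₀)) :* (G₁ :- Z₆ :* G₀)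
          :+ ((:1 :+ y :* q) :* G₀ :* H₀) :* (P :* (Z₆ :* (Z₆ :* q :^ 1)) :- Q₁ :* Q))
        refl (q ^ (2 ℕ.* j ℕ.* (1 ℕ.+ 3 ℕ.* s))) (q ^ (6 ℕ.* s)) (g s 1) (g s 0) (h 1) (h 0)
             (q ^ (2 ℕ.* j ℕ.+ 1)) (q ^ (2 ℕ.* (2 ℕ.+ j) ℕ.* (0 ℕ.+ 3 ℕ.* s))) q y)
      (*⊖-cancel h-rec₁ +₀ *⊖-cancel (g-stepᴷ s 0)
        +₀ *⊖-cancel (^-regroup₄ q (2 ℕ.* j ℕ.* (1 ℕ.+ 3 ℕ.* s)) (6 ℕ.* s) (6 ℕ.* s) 1
                                   (2 ℕ.* j ℕ.+ 1) (2 ℕ.* (2 ℕ.+ j) ℕ.* (0 ℕ.+ 3 ℕ.* s)) (solveℕ (j ∷ s ∷ []))))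
    ΔhW≈X₁+X₂ j s (suc (suc K)) = ≈-by-combination
      (solve 17 (λ P Z₆ G₂ G₁ G₀ H₂ H₁ H₀ Z A₅ A₆ Q₁ Q Q₂ Q′ y q →
          P :* Z₆ :* G₂ :* ((:1 :- Z) :* H₂) :- ((:1 :+ y :* q) :* Q₁ :* (Q :* G₁ :* H₁) :+ y :* Q₂ :* (Q′ :* G₀ :* H₀))
        ⊜ (P :* Z₆ :* G₂) :* ((:1 :- Z) :* H₂ :- ((:1 :+ y :* q) :* A₅ :* H₁ :+ y :* A₆ :* H₀))
          :+ (P :* Z₆ :* ((:1 :+ y :* q) :* A₅ :* H₁ :+ y :* A₆ :* H₀)) :* (G₂ :- Z₆ :* G₁)
          :+ (P :* Z₆ :* Z₆ :* y :* A₆ :* H₀) :* (G₁ :- Z₆ :* G₀)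
          :+ ((:1 :+ y :* q) :* G₁ :* H₁) :* (P :* (Z₆ :* (Z₆ :* A₅)) :- Q₁ :* Q)
          :+ (y :* G₀ :* H₀) :* (P :* (Z₆ :* (Z₆ :* (Z₆ :* A₆))) :- Q₂ :* Q′))
        refl (q ^ (2 ℕ.* j ℕ.* (suc (suc K) ℕ.+ 3 ℕ.* s))) (q ^ (6 ℕ.* s))
             (g s (suc (suc K))) (g s (suc K)) (g s K) (h (suc (suc K))) (h (suc K)) (h K)
             (q ^ (2 ℕ.* suc (suc K))) (q ^ (4 ℕ.* K ℕ.+ 5)) (q ^ (6 ℕ.* K ℕ.+ 5))
             (q ^ (2 ℕ.* j ℕ.+ 1)) (q ^ (2 ℕ.* (2 ℕ.+ j) ℕ.* (suc K ℕ.+ 3 ℕ.* s)))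
             (q ^ (4 ℕ.* j ℕ.+ 5)) (q ^ (2 ℕ.* (3 ℕ.+ j) ℕ.* (K ℕ.+ 3 ℕ.* s))) y q)
      (*⊖-cancel (h-rec K) +₀ *⊖-cancel (g-stepᴷ s (suc K)) +₀ *⊖-cancel (g-stepᴷ s K)
        +₀ *⊖-cancel (^-regroup₄ q (2 ℕ.* j ℕ.* (suc (suc K) ℕ.+ 3 ℕ.* s)) (6 ℕ.* s) (6 ℕ.* s) (4 ℕ.* K ℕ.+ 5)
                                   (2 ℕ.* j ℕ.+ 1) (2 ℕ.* (2 ℕ.+ j) ℕ.* (suc K ℕ.+ 3 ℕ.* s)) (solveℕ (j ∷ s ∷ K ∷ [])))
        +₀ *⊖-cancel (^-regroup₅ q (2 ℕ.* j ℕ.* (suc (suc K) ℕ.+ 3 ℕ.* s)) (6 ℕ.* s) (6 ℕ.* s) (6 ℕ.* s) (6 ℕ.* K ℕ.+ 5)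
                                   (4 ℕ.* j ℕ.+ 5) (2 ℕ.* (3 ℕ.+ j) ℕ.* (K ℕ.+ 3 ℕ.* s)) (solveℕ (j ∷ s ∷ K ∷ []))))

    W-difference : ∀ j s K → W j s K ⊖ W (suc j) s K ≈ X₁ j s K + X₂ j s K ⊖ X₃ j s K
    W-difference j s K = trans (W-split j s K) (trans (+-cong (ΔgW≈-X₃ j s K) (ΔhW≈X₁+X₂ j s K))
      (solve 3 (λ a b c → ⊝ c :+ (a :+ b) ⊜ a :+ b :- c) refl (X₁ j s K) (X₂ j s K) (X₃ j s K)))

    A-difference : ∀ j M → A j M ⊖ A (suc j) M ≈ Σ₊₂ M (X₁ j) + Σ₊₂ M (X₂ j) ⊖ Σ₊₂ M (X₃ j)
    A-difference j M = begin
      A j M ⊖ A (suc j) M                                  ≈⟨ Σ₊₂-⊖ M (W j) (W (suc j)) ⟨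
      Σ₊₂ M (λ s K → W j s K ⊖ W (suc j) s K)              ≈⟨ Σ₊₂-cong M (W-difference j) ⟩
      Σ₊₂ M (λ s K → X₁ j s K + X₂ j s K ⊖ X₃ j s K)       ≈⟨ Σ₊₂-⊖ M _ (X₃ j) ⟩
      Σ₊₂ M (λ s K → X₁ j s K + X₂ j s K) ⊖ Σ₊₂ M (X₃ j)   ≈⟨ +-congʳ (Σ₊₂-+ M (X₁ j) (X₂ j)) ⟩
      Σ₊₂ M (X₁ j) + Σ₊₂ M (X₂ j) ⊖ Σ₊₂ M (X₃ j)           ∎

    A-rec₁ : ∀ j M → A j (suc (suc M)) ⊖ A (suc j) (suc (suc M))
                     ≈ (1# + y * q) * q ^ (2 ℕ.* j ℕ.+ 1) * A (2 ℕ.+ j) (suc M)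
                       + y * q ^ (4 ℕ.* j ℕ.+ 5) * A (3 ℕ.+ j) M ⊖ y * q ^ (6 ℕ.* j ℕ.+ 9) * A (3 ℕ.+ j) M
    A-rec₁ j M = trans (A-difference j (suc (suc M))) (+-cong (+-cong
        (trans (Σ₊₂-shiftᴷ (suc M) (X₁ j) (λ _ → refl)) (Σ₊₂-* (suc M) _ (W (2 ℕ.+ j))))
        (trans (Σ₊₂-shiftᴷ (suc M) (X₂ j) (λ _ → refl))
          (trans (Σ₊₂-shiftᴷ M (λ s K → X₂ j s (suc K)) (λ _ → refl)) (Σ₊₂-* M _ (W (3 ℕ.+ j))))))
      (-‿cong (trans (Σ₊₂-shiftˢ M (X₃ j) (λ _ → refl)) (Σ₊₂-* M _ (W (3 ℕ.+ j))))))

    -- Â j n = A j (n ∸ 3) for n ≥ 3, and 0 below: both recurrences then hold at every index.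
    Â : ℕ → ℕ → Carrier
    Â j (suc (suc (suc n))) = A j n
    Â j _ = 0#

    Â-rec₁ : ∀ j n → Â j (2 ℕ.+ n) ⊖ Â (1 ℕ.+ j) (2 ℕ.+ n)
                     ≈ (1# + y * q) * q ^ (2 ℕ.* j ℕ.+ 1) * Â (2 ℕ.+ j) (1 ℕ.+ n)
                       + y * (q ^ (4 ℕ.* j ℕ.+ 5) ⊖ q ^ (6 ℕ.* j ℕ.+ 9)) * Â (3 ℕ.+ j) n
    Â-rec₁ j zero = solve 5 (λ y q Q₁ Q₂ Q₃ → :0 :- :0 ⊜ (:1 :+ y :* q) :* Q₁ :* :0 :+ y :* (Q₂ :- Q₃) :* :0) refl _ _ _ _ _
    Â-rec₁ j (suc zero) = trans (A-difference j 0)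
      (solve 5 (λ y q Q₁ Q₂ Q₃ → :0 :+ :0 :- :0 ⊜ (:1 :+ y :* q) :* Q₁ :* :0 :+ y :* (Q₂ :- Q₃) :* :0) refl _ _ _ _ _)
    Â-rec₁ j (suc (suc zero)) = trans (A-difference j 1)
      (solve 6 (λ w y q Q₁ Q₂ Q₃ → (:1 :+ y :* q) :* Q₁ :* w :+ :0 :- :0 ⊜ (:1 :+ y :* q) :* Q₁ :* w :+ y :* (Q₂ :- Q₃) :* :0)
         refl (W (2 ℕ.+ j) 0 0) _ _ _ _ _)
    Â-rec₁ j (suc (suc (suc n))) = trans (A-rec₁ j n)
      (solve 7 (λ x₂ x₃ y q Q₁ Q₂ Q₃ →
         (:1 :+ y :* q) :* Q₁ :* x₂ :+ y :* Q₂ :* x₃ :- y :* Q₃ :* x₃ ⊜ (:1 :+ y :* q) :* Q₁ :* x₂ :+ y :* (Q₂ :- Q₃) :* x₃)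
         refl (A (2 ℕ.+ j) (suc n)) (A (3 ℕ.+ j) n) _ _ _ _ _)

    W⁻ : ℕ → ℕ → ℕ → Carrier
    W⁻ j zero K = 0#
    W⁻ j (suc s) K = W (3 ℕ.+ j) s K

    W-scale : ∀ j s K → q ^ (6 ℕ.* (K ℕ.+ 2 ℕ.* s)) * W j s K ⊖ W (3 ℕ.+ j) s K
                        ≈ - (y * q ^ (6 ℕ.* (K ℕ.+ 2 ℕ.* s)) * q ^ (6 ℕ.* j ℕ.+ 9)) * W⁻ j s K
    W-scale j zero K = ≈-by-combination
      (solve 7 (λ E P Q G H y Q₉ → E :* (P :* G :* H) :- Q :* G :* H :- ⊝ (y :* E :* Q₉) :* :0
                                  ⊜ (G :* H) :* (E :* P :- Q))
         refl (q ^ (6 ℕ.* (K ℕ.+ 2 ℕ.* 0))) (q ^ (2 ℕ.* j ℕ.* (K ℕ.+ 3 ℕ.* 0))) (q ^ (2 ℕ.* (3 ℕ.+ j) ℕ.* (K ℕ.+ 3 ℕ.* 0)))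
              (g 0 K) (h K) y (q ^ (6 ℕ.* j ℕ.+ 9)))
      (*⊖-cancel (sym (^-split q (2 ℕ.* (3 ℕ.+ j) ℕ.* (K ℕ.+ 3 ℕ.* 0)) (6 ℕ.* (K ℕ.+ 2 ℕ.* 0))
                                  (2 ℕ.* j ℕ.* (K ℕ.+ 3 ℕ.* 0)) (solveℕ (j ∷ K ∷ [])))))
    W-scale j (suc s) K = ≈-by-combination
      (solve 11 (λ E P Q G G′ H y Q₉ Z D Q′ →
          E :* (P :* G :* H) :- Q :* G :* H :- ⊝ (y :* E :* Q₉) :* (Q′ :* G′ :* H)
        ⊜ (E :* P :* H) :* ((:1 :- Z) :* G :- ⊝ (y :* D) :* G′)
          :+ (⊝ (y :* E :* H :* G′)) :* (P :* D :- Q₉ :* Q′)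
          :+ (⊝ (G :* H)) :* (Q :- E :* (P :* Z)))
         refl (q ^ (6 ℕ.* (K ℕ.+ 2 ℕ.* suc s))) (q ^ (2 ℕ.* j ℕ.* (K ℕ.+ 3 ℕ.* suc s)))
              (q ^ (2 ℕ.* (3 ℕ.+ j) ℕ.* (K ℕ.+ 3 ℕ.* suc s))) (g (suc s) K) (g s K) (h K) y (q ^ (6 ℕ.* j ℕ.+ 9))
              (q ^ (6 ℕ.* suc s)) (q ^ (18 ℕ.* s ℕ.+ 9 ℕ.+ 6 ℕ.* K)) (q ^ (2 ℕ.* (3 ℕ.+ j) ℕ.* (K ℕ.+ 3 ℕ.* s))))
      (*⊖-cancel (g-stepˢ s K)
        +₀ *⊖-cancel (^-regroup q (2 ℕ.* j ℕ.* (K ℕ.+ 3 ℕ.* suc s)) (18 ℕ.* s ℕ.+ 9 ℕ.+ 6 ℕ.* K)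
                                  (6 ℕ.* j ℕ.+ 9) (2 ℕ.* (3 ℕ.+ j) ℕ.* (K ℕ.+ 3 ℕ.* s)) (solveℕ (j ∷ s ∷ K ∷ [])))
        +₀ *⊖-cancel (trans (^-split q (2 ℕ.* (3 ℕ.+ j) ℕ.* (K ℕ.+ 3 ℕ.* suc s)) (6 ℕ.* (K ℕ.+ 2 ℕ.* suc s))
                               (2 ℕ.* j ℕ.* (K ℕ.+ 3 ℕ.* suc s) ℕ.+ 6 ℕ.* suc s) (solveℕ (j ∷ s ∷ K ∷ [])))
                            (*-congˡ (^-+ q (2 ℕ.* j ℕ.* (K ℕ.+ 3 ℕ.* suc s)) (6 ℕ.* suc s)))))

    A-rec₂ : ∀ j M → q ^ (6 ℕ.* M) * A j M ⊖ A (3 ℕ.+ j) M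
                     ≈ - (y * q ^ (6 ℕ.* M) * q ^ (6 ℕ.* j ℕ.+ 9)) * Σ₊₂ M (W⁻ j)
    A-rec₂ j M = begin
      q ^ (6 ℕ.* M) * A j M ⊖ A (3 ℕ.+ j) M
        ≈⟨ +-congʳ (Σ₊₂-* M _ (W j)) ⟨
      Σ₊₂ M (λ s K → q ^ (6 ℕ.* M) * W j s K) ⊖ A (3 ℕ.+ j) M
        ≈⟨ Σ₊₂-⊖ M _ (W (3 ℕ.+ j)) ⟨
      Σ₊₂ M (λ s K → q ^ (6 ℕ.* M) * W j s K ⊖ W (3 ℕ.+ j) s K)
        ≈⟨ Σ₊₂-restrict M (λ m s K → q ^ (6 ℕ.* m) * W j s K ⊖ W (3 ℕ.+ j) s K) ⟨
      Σ₊₂ M (λ s K → q ^ (6 ℕ.* (K ℕ.+ 2 ℕ.* s)) * W j s K ⊖ W (3 ℕ.+ j) s K)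
        ≈⟨ Σ₊₂-cong M (W-scale j) ⟩
      Σ₊₂ M (λ s K → - (y * q ^ (6 ℕ.* (K ℕ.+ 2 ℕ.* s)) * q ^ (6 ℕ.* j ℕ.+ 9)) * W⁻ j s K)
        ≈⟨ Σ₊₂-restrict M (λ m s K → - (y * q ^ (6 ℕ.* m) * q ^ (6 ℕ.* j ℕ.+ 9)) * W⁻ j s K) ⟩
      Σ₊₂ M (λ s K → - (y * q ^ (6 ℕ.* M) * q ^ (6 ℕ.* j ℕ.+ 9)) * W⁻ j s K)
        ≈⟨ Σ₊₂-* M _ (W⁻ j) ⟩
      - (y * q ^ (6 ℕ.* M) * q ^ (6 ℕ.* j ℕ.+ 9)) * Σ₊₂ M (W⁻ j) ∎

    Â-rec₂ : ∀ j n → q ^ (6 ℕ.* n) * Â j (3 ℕ.+ n) ⊖ Â (3 ℕ.+ j) (3 ℕ.+ n)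
                     ≈ - (y * q ^ (6 ℕ.* n) * q ^ (6 ℕ.* j ℕ.+ 9)) * Â (3 ℕ.+ j) (1 ℕ.+ n)
    Â-rec₂ j n = trans (A-rec₂ j n) (*-congˡ (Σ₊₂-W⁻ n))
      where
      Σ₊₂-W⁻ : ∀ n → Σ₊₂ n (W⁻ j) ≈ Â (3 ℕ.+ j) (1 ℕ.+ n)
      Σ₊₂-W⁻ zero = refl
      Σ₊₂-W⁻ (suc zero) = refl
      Σ₊₂-W⁻ (suc (suc n)) = Σ₊₂-shiftˢ n (W⁻ j) (λ _ → refl)

    Â-rec₂⁻ : ∀ j M → q ^ (6 ℕ.* M) * Â j (2 ℕ.+ M) ⊖ q ^ 6 * Â (3 ℕ.+ j) (2 ℕ.+ M)
                      ≈ - (y * q ^ (6 ℕ.* M) * q ^ (6 ℕ.* j ℕ.+ 9)) * Â (3 ℕ.+ j) M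
    Â-rec₂⁻ j zero = solve 4 (λ E Q₆ y Q₉ → E :* :0 :- Q₆ :* :0 ⊜ ⊝ (y :* E :* Q₉) :* :0) refl _ _ _ _
    Â-rec₂⁻ j (suc M) = ≈-by-combination
      (solve 8 (λ E E′ Q₆ y Q₉ x₀ x₃ x₃′ →
          E :* x₀ :- Q₆ :* x₃ :- ⊝ (y :* E :* Q₉) :* x₃′
        ⊜ Q₆ :* ((E′ :* x₀ :- x₃) :- ⊝ (y :* E′ :* Q₉) :* x₃′) :+ (x₀ :+ y :* Q₉ :* x₃′) :* (E :- Q₆ :* E′))
        refl (q ^ (6 ℕ.* suc M)) (q ^ (6 ℕ.* M)) (q ^ 6) y (q ^ (6 ℕ.* j ℕ.+ 9))
             (Â j (3 ℕ.+ M)) (Â (3 ℕ.+ j) (3 ℕ.+ M)) (Â (3 ℕ.+ j) (1 ℕ.+ M)))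
      (*⊖-cancel (Â-rec₂ j M) +₀ *⊖-cancel (^-split q (6 ℕ.* suc M) 6 (6 ℕ.* M) (solveℕ (M ∷ []))))

module CertificateTerms where

  open import Data.Fin using (_↑ʳ_; combine; #_)
  open import Data.Integer using (ℤ)
  open import Data.List using (List; _∷_; [])
  open import Data.Nat.DivMod using (_mod_)
  open import Data.Product using (_×_; _,_)

  open IntegerExpressions

  Term : Set
  Term = Expr ℤ 52

  -- The variables stand for q, y, E = q^(6M), F = q^(12M) and, for j < 6 and l < 8, b j l = Â j (l + M).
  q̂ ŷ Ê F̂ : Term
  q̂ = Ι (# 0)
  ŷ = Ι (# 1)
  Ê = Ι (# 2)
  F̂ = Ι (# 3)

  b : ℕ → ℕ → Term
  b j l = Ι (4 ↑ʳ combine (j mod 6) (l mod 8))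

  a : ℕ → Term
  a k = b 0 (3 ℕ.+ k)

  qᴱ qᶠ : ℕ → Term
  qᴱ zero = Ê
  qᴱ (suc n) = q̂ :* qᴱ n
  qᶠ zero = F̂
  qᶠ (suc n) = q̂ :* qᶠ n

  R₁ R₂ : ℕ → ℕ → Term × Term
  R₁ j l = b j (2 ℕ.+ l) :- b (1 ℕ.+ j) (2 ℕ.+ l)
         , (:1 :+ ŷ :* q̂) :* q̂ :^ (2 ℕ.* j ℕ.+ 1) :* b (2 ℕ.+ j) (1 ℕ.+ l)
           :+ ŷ :* (q̂ :^ (4 ℕ.* j ℕ.+ 5) :- q̂ :^ (6 ℕ.* j ℕ.+ 9)) :* b (3 ℕ.+ j) l
  R₂ j k = qᴱ (6 ℕ.* k) :* b j (3 ℕ.+ k) :- b (3 ℕ.+ j) (3 ℕ.+ k)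
         , ⊝ (ŷ :* qᴱ (6 ℕ.* k) :* q̂ :^ (6 ℕ.* j ℕ.+ 9)) :* b (3 ℕ.+ j) (1 ℕ.+ k)

  R₂⁻ : ℕ → Term × Term
  R₂⁻ j = Ê :* b j 2 :- q̂ :^ 6 :* b (3 ℕ.+ j) 2 , ⊝ (ŷ :* Ê :* q̂ :^ (6 ℕ.* j ℕ.+ 9)) :* b (3 ℕ.+ j) 0

  Rsq : Term × Term
  Rsq = F̂ , Ê :* Ê

  Monomial : Set
  Monomial = ℤ × ℕ × ℕ × ℕ

  poly : List Monomial → Term
  poly [] = :0
  poly ((c , i , j , k) ∷ ms) = Κ c :* q̂ ⊛ i :* ŷ ⊛ j :* Ê ⊛ k :+ poly ms

  module StatementTerm where
    infixl 6 _+_ _⊖_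
    infixl 7 _*_
    infixr 8 _^_

    _+_ _*_ _⊖_ : Term → Term → Term
    _+_ = _:+_
    _*_ = _:*_
    _⊖_ = _:-_

    _^_ : Term → ℕ → Term
    _^_ = _:^_

    1# two three q y : Term
    1# = :1
    two = 1# + 1#
    three = 1# + 1# + 1#
    q = q̂
    y = ŷ

    recurrence : Term
    recurrence =
        qᶠ 24 * y ^ 2
          * (1# + two * y * q + y ^ 2 * q ^ 2 + qᴱ 22 + y * qᴱ 23
             + y ^ 2 * qᴱ 24)
          * a 0
      ⊖ qᶠ 27 * (1# + y * q)
          * (1# + y * q + y ^ 2 * q ^ 2 ⊖ y ^ 2 * q ^ 8 + y ^ 3 * q ^ 3 + y ^ 4 * q ^ 4
             + qᴱ 22 + y ^ 2 * qᴱ 24 + y ^ 4 * qᴱ 26)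
          * a 1
      ⊖ qᴱ 17
          * (y + y * q ^ 2 + two * y ^ 2 * q + two * y ^ 2 * q ^ 3 + y ^ 3 * q ^ 2
             + y ^ 3 * q ^ 4 ⊖ qᴱ 15 + qᴱ 21 ⊖ two * y * qᴱ 16
             + two * y * qᴱ 22 + y * qᴱ 24 ⊖ y * qᶠ 38
             ⊖ three * y ^ 2 * qᴱ 17 + two * y ^ 2 * qᴱ 23
             + y ^ 2 * qᴱ 25 ⊖ y ^ 2 * qᶠ 39
             ⊖ two * y ^ 3 * qᴱ 18 + two * y ^ 3 * qᴱ 24
             + y ^ 3 * qᴱ 26 ⊖ y ^ 3 * qᶠ 40
             ⊖ y ^ 4 * qᴱ 19 + y ^ 4 * qᴱ 25)
          * a 2
      ⊖ qᴱ 17 * (1# + q ^ 2 + q ^ 4) * (1# + y * q)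
          * (1# + y * q + y * q ^ 3 + y ^ 2 * q ^ 2 + qᴱ 20 + y * qᴱ 21
             + y ^ 2 * qᴱ 22)
          * a 3
      + (1# ⊖ qᴱ 24)
          * (1# + two * y * q + y ^ 2 * q ^ 2 + qᴱ 16 + y * qᴱ 17
             + y ^ 2 * qᴱ 18)
          * a 4

module AtomValues {c ℓ} (R : CommutativeRing c ℓ) where

  open import Data.Fin using (toℕ)
  open import Data.Vec using (Vec; _∷_; concat; tabulate)
  open CommutativeRing R
  open QDefs R
  open Powers R using (^-split)
  open Recurrences R

  module Valuation (q y : Carrier) (inv : ℕ → Carrier)
                   (inv-inverse : ∀ m → (1# ⊖ q ^ suc m) * inv m ≈ 1#) (M : ℕ) where

    open Sequences q y inv inv-inverse

    -- ã (M + k) itself rather than Â 0 (k + 3 + M), so that the recurrence term evaluates to the statement.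
    value : ℕ → ℕ → Carrier
    value zero (suc (suc (suc zero))) = ã q y inv M
    value zero (suc (suc (suc (suc k)))) = ã q y inv (M ℕ.+ suc k)
    value j l = Â j (l ℕ.+ M)

    ρ : Vec Carrier 52
    ρ = q ∷ y ∷ q ^ (6 ℕ.* M) ∷ q ^ (12 ℕ.* M)
          ∷ concat (tabulate {n = 6} λ j → tabulate {n = 8} λ l → value (toℕ j) (toℕ l))

    value≈Â : ∀ j l → value j l ≈ Â j (l ℕ.+ M)
    value≈Â zero 0 = refl
    value≈Â zero 1 = refl
    value≈Â zero 2 = refl
    value≈Â zero 3 = ã≈A₀ M
    value≈Â zero (suc (suc (suc (suc k)))) =
      trans (ã≈A₀ (M ℕ.+ suc k)) (reflexive (≡.cong (A 0) (ℕ.+-comm M (suc k))))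
    value≈Â (suc j) l = refl

    rel₁ : ∀ j l → value j (2 ℕ.+ l) ⊖ value (1 ℕ.+ j) (2 ℕ.+ l)
                   ≈ (1# + y * q) * q ^ (2 ℕ.* j ℕ.+ 1) * value (2 ℕ.+ j) (1 ℕ.+ l)
                     + y * (q ^ (4 ℕ.* j ℕ.+ 5) ⊖ q ^ (6 ℕ.* j ℕ.+ 9)) * value (3 ℕ.+ j) l
    rel₁ j l = trans (+-congʳ (value≈Â j (2 ℕ.+ l))) (Â-rec₁ j (l ℕ.+ M))

    rel₂ : ∀ j k → q ^ (6 ℕ.* k ℕ.+ 6 ℕ.* M) * value j (3 ℕ.+ k) ⊖ value (3 ℕ.+ j) (3 ℕ.+ k)
                   ≈ - (y * q ^ (6 ℕ.* k ℕ.+ 6 ℕ.* M) * q ^ (6 ℕ.* j ℕ.+ 9)) * value (3 ℕ.+ j) (1 ℕ.+ k)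
    rel₂ j k = trans (+-congʳ (*-congˡ (value≈Â j (3 ℕ.+ k))))
      (≡.subst (λ e → q ^ e * Â j (3 ℕ.+ (k ℕ.+ M)) ⊖ Â (3 ℕ.+ j) (3 ℕ.+ (k ℕ.+ M))
                      ≈ - (y * q ^ e * q ^ (6 ℕ.* j ℕ.+ 9)) * Â (3 ℕ.+ j) (1 ℕ.+ (k ℕ.+ M)))
               (ℕ.*-distribˡ-+ 6 k M) (Â-rec₂ j (k ℕ.+ M)))

    rel₂⁻ : ∀ j → q ^ (6 ℕ.* M) * value j 2 ⊖ q ^ 6 * value (3 ℕ.+ j) 2
                  ≈ - (y * q ^ (6 ℕ.* M) * q ^ (6 ℕ.* j ℕ.+ 9)) * value (3 ℕ.+ j) 0
    rel₂⁻ j = trans (+-congʳ (*-congˡ (value≈Â j 2))) (Â-rec₂⁻ j M)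

    rel-sq : q ^ (12 ℕ.* M) ≈ q ^ (6 ℕ.* M) * q ^ (6 ℕ.* M)
    rel-sq = ^-split q (12 ℕ.* M) (6 ℕ.* M) (6 ℕ.* M) (ℕ.*-distribʳ-+ M 6 6)

module RecurrenceCertificate {c ℓ} (R : CommutativeRing c ℓ) where

  open import Data.Integer as ℤ using (ℤ; +_)
  open import Data.List using (List; _∷_; [])
  open import Data.Product using (Σ-syntax; _×_; _,_)
  open CommutativeRing R using (Carrier; _≈_; _*_; 1#; 0#; refl; trans; +-cong; +-identityʳ)
  open QDefs R using (_⊖_; _^_)

  module Certificate (q y : Carrier) (inv : ℕ → Carrier)
                     (inv-inverse : ∀ m → (1# ⊖ q ^ suc m) * inv m ≈ 1#) (M : ℕ) where

    open IntegerExpressions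
    open IntegerRingSolver R using (⟦_⟧; prove; *⊖-cancel)
    open AtomValues R
    open Valuation q y inv inv-inverse M
    open CertificateTerms
    open StatementTerm using (recurrence)

    -_ : ℕ → ℤ
    - n = ℤ.- (+ n)

    Entry : Set _
    Entry = Σ[ (l , r) ∈ Term × Term ] (⟦ l ⟧ ρ ≈ ⟦ r ⟧ ρ) × Term

    entry : (lr : Term × Term) → let (l , r) = lr in ⟦ l ⟧ ρ ≈ ⟦ r ⟧ ρ → Term → Entry
    entry lr l≈r c = lr , l≈r , c

    combination : List Entry → Term
    combination [] = :0
    combination (((l , r) , _ , c) ∷ es) = c :* (l :- r) :+ combination es

    combination≈0 : ∀ es → ⟦ combination es ⟧ ρ ≈ 0#
    combination≈0 [] = refl
    combination≈0 (((l , r) , l≈r , c) ∷ es) = trans (+-cong (*⊖-cancel l≈r) (combination≈0 es)) (+-identityʳ 0#)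

    -- The combination eliminates Â 1, …, Â 5 and q^(12M), leaving the recurrence for Â 0.
    entries : List Entry
    entries =
          entry (R₁ 0 1) (rel₁ 0 1)
          (poly ((+ 1 , 28 , 2 , 2) ∷ (+ 2 , 29 , 3 , 2) ∷ (+ 1 , 30 , 4 , 2) ∷ (+ 1 , 50 , 2 , 3) ∷
                (+ 1 , 51 , 3 , 3) ∷ (+ 1 , 52 , 4 , 3) ∷ []))
      ∷ entry (R₂ 0 0) (rel₂ 0 0)
          (poly ((+ 1 , 24 , 2 , 1) ∷ (+ 2 , 25 , 3 , 1) ∷ (+ 1 , 26 , 4 , 1) ∷ (- 1 , 28 , 2 , 1) ∷
                (- 2 , 29 , 3 , 1) ∷ (- 1 , 30 , 4 , 1) ∷ (+ 1 , 46 , 2 , 2) ∷ (+ 1 , 47 , 3 , 2) ∷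
                (+ 1 , 48 , 4 , 2) ∷ (- 1 , 50 , 2 , 2) ∷ (- 1 , 51 , 3 , 2) ∷ (- 1 , 52 , 4 , 2) ∷ []))
      ∷ entry (R₁ 0 2) (rel₁ 0 2)
          (poly ((+ 1 , 32 , 1 , 2) ∷ (+ 2 , 33 , 2 , 2) ∷ (+ 2 , 34 , 3 , 2) ∷ (+ 1 , 35 , 4 , 2) ∷
                (+ 1 , 39 , 2 , 2) ∷ (+ 1 , 40 , 3 , 2) ∷ (+ 1 , 54 , 1 , 3) ∷ (+ 2 , 55 , 2 , 3) ∷
                (+ 2 , 56 , 3 , 3) ∷ (+ 1 , 57 , 4 , 3) ∷ []))
      ∷ entry (R₂ 0 1) (rel₂ 0 1)
          (poly ((- 1 , 21 , 0 , 1) ∷ (- 2 , 22 , 1 , 1) ∷ (- 2 , 23 , 2 , 1) ∷ (- 2 , 24 , 3 , 1) ∷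
                (- 2 , 25 , 4 , 1) ∷ (- 1 , 26 , 1 , 1) ∷ (- 1 , 26 , 5 , 1) ∷ (- 2 , 27 , 2 , 1) ∷
                (- 2 , 28 , 3 , 1) ∷ (+ 1 , 29 , 2 , 1) ∷ (- 1 , 29 , 4 , 1) ∷ (+ 1 , 30 , 3 , 1) ∷
                (- 1 , 33 , 2 , 1) ∷ (- 1 , 34 , 3 , 1) ∷ (- 1 , 43 , 0 , 2) ∷ (- 1 , 44 , 1 , 2) ∷
                (- 1 , 45 , 2 , 2) ∷ (- 1 , 46 , 3 , 2) ∷ (- 1 , 47 , 4 , 2) ∷ (- 1 , 48 , 1 , 2) ∷
                (- 1 , 48 , 5 , 2) ∷ (- 2 , 49 , 2 , 2) ∷ (- 2 , 50 , 3 , 2) ∷ (- 1 , 51 , 4 , 2) ∷ []))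
      ∷ entry (R₁ 0 3) (rel₁ 0 3)
          (poly ((- 1 , 19 , 1 , 1) ∷ (- 2 , 20 , 2 , 1) ∷ (- 1 , 21 , 1 , 1) ∷ (- 1 , 21 , 3 , 1) ∷
                (- 2 , 22 , 2 , 1) ∷ (- 1 , 23 , 3 , 1) ∷ (- 1 , 37 , 1 , 2) ∷ (- 1 , 38 , 2 , 2) ∷
                (- 1 , 39 , 3 , 2) ∷ (- 1 , 41 , 1 , 2) ∷ (- 1 , 42 , 2 , 2) ∷ (- 1 , 43 , 3 , 2) ∷ []))
      ∷ entry (R₂ 0 2) (rel₂ 0 2)
          (poly ((- 1 , 5 , 1 , 0) ∷ (- 2 , 6 , 2 , 0) ∷ (- 1 , 7 , 3 , 0) ∷ (+ 1 , 9 , 1 , 0) ∷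
                (+ 2 , 10 , 2 , 0) ∷ (+ 1 , 11 , 3 , 0) ∷ (+ 1 , 20 , 0 , 1) ∷ (+ 2 , 21 , 1 , 1) ∷
                (+ 3 , 22 , 2 , 1) ∷ (+ 2 , 23 , 3 , 1) ∷ (+ 1 , 24 , 4 , 1) ∷ (+ 1 , 25 , 1 , 1) ∷
                (- 1 , 26 , 0 , 1) ∷ (+ 1 , 26 , 2 , 1) ∷ (- 2 , 27 , 1 , 1) ∷ (+ 1 , 27 , 3 , 1) ∷
                (- 2 , 28 , 2 , 1) ∷ (- 2 , 29 , 3 , 1) ∷ (- 1 , 30 , 4 , 1) ∷ (+ 1 , 43 , 1 , 2) ∷
                (+ 1 , 44 , 2 , 2) ∷ (+ 1 , 45 , 3 , 2) ∷ []))
      ∷ entry (R₁ 0 4) (rel₁ 0 4)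
          (poly ((- 1 , 17 , 0 , 1) ∷ (- 2 , 18 , 1 , 1) ∷ (- 2 , 19 , 2 , 1) ∷ (- 1 , 20 , 3 , 1) ∷
                (- 1 , 24 , 1 , 1) ∷ (- 1 , 25 , 2 , 1) ∷ (- 1 , 39 , 0 , 2) ∷ (- 2 , 40 , 1 , 2) ∷
                (- 2 , 41 , 2 , 2) ∷ (- 1 , 42 , 3 , 2) ∷ []))
      ∷ entry (R₂ 0 3) (rel₂ 0 3)
          (poly ((- 1 , 1 , 0 , 0) ∷ (- 3 , 2 , 1 , 0) ∷ (- 1 , 3 , 0 , 0) ∷ (- 3 , 3 , 2 , 0) ∷
                (- 3 , 4 , 1 , 0) ∷ (- 1 , 4 , 3 , 0) ∷ (- 3 , 5 , 2 , 0) ∷ (- 1 , 6 , 3 , 0) ∷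
                (- 1 , 19 , 0 , 1) ∷ (- 2 , 20 , 1 , 1) ∷ (- 2 , 21 , 2 , 1) ∷ (- 1 , 22 , 3 , 1) ∷
                (- 1 , 23 , 0 , 1) ∷ (- 2 , 24 , 1 , 1) ∷ (- 2 , 25 , 2 , 1) ∷ (- 1 , 26 , 3 , 1) ∷ []))
      ∷ entry (R₁ 0 5) (rel₁ 0 5)
          (poly ((+ 1 , 0 , 0 , 0) ∷ (+ 2 , 1 , 1 , 0) ∷ (+ 1 , 2 , 2 , 0) ∷ (+ 1 , 16 , 0 , 1) ∷
                (+ 1 , 17 , 1 , 1) ∷ (+ 1 , 18 , 2 , 1) ∷ []))
      ∷ entry (R₂ 0 4) (rel₂ 0 4)
          (poly ((- 1 , 0 , 0 , 0) ∷ (- 2 , 1 , 1 , 0) ∷ (- 1 , 2 , 2 , 0) ∷ (- 1 , 16 , 0 , 1) ∷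
                (- 1 , 17 , 1 , 1) ∷ (- 1 , 18 , 2 , 1) ∷ []))
      ∷ entry (R₁ 1 1) (rel₁ 1 1)
          (poly ((- 1 , 33 , 1 , 2) ∷ (- 3 , 34 , 2 , 2) ∷ (- 4 , 35 , 3 , 2) ∷ (- 3 , 36 , 4 , 2) ∷
                (- 1 , 37 , 5 , 2) ∷ (- 1 , 55 , 1 , 3) ∷ (- 2 , 56 , 2 , 3) ∷ (- 3 , 57 , 3 , 3) ∷
                (- 2 , 58 , 4 , 3) ∷ (- 1 , 59 , 5 , 3) ∷ []))
      ∷ entry (R₂ 1 0) (rel₂ 1 0)
          (poly ((+ 1 , 28 , 2 , 1) ∷ (+ 2 , 29 , 3 , 1) ∷ (+ 1 , 30 , 4 , 1) ∷ (+ 1 , 33 , 1 , 1) ∷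
                (+ 3 , 34 , 2 , 1) ∷ (+ 4 , 35 , 3 , 1) ∷ (+ 3 , 36 , 4 , 1) ∷ (+ 1 , 37 , 5 , 1) ∷
                (+ 1 , 50 , 2 , 2) ∷ (+ 1 , 51 , 3 , 2) ∷ (+ 1 , 52 , 4 , 2) ∷ (+ 1 , 55 , 1 , 2) ∷
                (+ 2 , 56 , 2 , 2) ∷ (+ 3 , 57 , 3 , 2) ∷ (+ 2 , 58 , 4 , 2) ∷ (+ 1 , 59 , 5 , 2) ∷ []))
      ∷ entry (R₁ 1 2) (rel₁ 1 2)
          (poly ((+ 1 , 38 , 1 , 2) ∷ (+ 2 , 39 , 2 , 2) ∷ (+ 2 , 40 , 3 , 2) ∷ (+ 1 , 41 , 4 , 2) ∷
                (- 1 , 44 , 1 , 2) ∷ (- 2 , 45 , 2 , 2) ∷ (- 2 , 46 , 3 , 2) ∷ (- 1 , 47 , 4 , 2) ∷ []))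
      ∷ entry (R₂ 1 1) (rel₂ 1 1)
          (poly ((+ 1 , 26 , 1 , 1) ∷ (+ 2 , 27 , 2 , 1) ∷ (+ 2 , 28 , 3 , 1) ∷ (+ 1 , 29 , 4 , 1) ∷
                (- 1 , 32 , 1 , 1) ∷ (- 1 , 33 , 2 , 1) ∷ (- 1 , 34 , 3 , 1) ∷ (- 1 , 35 , 4 , 1) ∷
                (+ 1 , 38 , 1 , 1) ∷ (+ 2 , 39 , 2 , 1) ∷ (+ 2 , 40 , 3 , 1) ∷ (+ 1 , 41 , 4 , 1) ∷
                (+ 1 , 48 , 1 , 2) ∷ (+ 2 , 49 , 2 , 2) ∷ (+ 2 , 50 , 3 , 2) ∷ (+ 1 , 51 , 4 , 2) ∷ []))
      ∷ entry (R₁ 1 3) (rel₁ 1 3)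
          (poly ((+ 1 , 18 , 0 , 1) ∷ (+ 3 , 19 , 1 , 1) ∷ (+ 4 , 20 , 2 , 1) ∷ (+ 3 , 21 , 3 , 1) ∷
                (+ 1 , 22 , 4 , 1) ∷ (- 1 , 27 , 1 , 1) ∷ (- 2 , 28 , 2 , 1) ∷ (- 1 , 29 , 3 , 1) ∷
                (+ 1 , 40 , 0 , 2) ∷ (+ 2 , 41 , 1 , 2) ∷ (+ 3 , 42 , 2 , 2) ∷ (- 1 , 43 , 1 , 2) ∷
                (+ 2 , 43 , 3 , 2) ∷ (- 1 , 44 , 2 , 2) ∷ (+ 1 , 44 , 4 , 2) ∷ (- 1 , 45 , 3 , 2) ∷ []))
      ∷ entry (R₂ 1 2) (rel₂ 1 2)
          (poly ((- 1 , 6 , 0 , 0) ∷ (- 4 , 7 , 1 , 0) ∷ (- 6 , 8 , 2 , 0) ∷ (- 1 , 9 , 1 , 0) ∷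
                (- 4 , 9 , 3 , 0) ∷ (- 2 , 10 , 2 , 0) ∷ (- 1 , 10 , 4 , 0) ∷ (- 1 , 11 , 3 , 0) ∷
                (+ 1 , 15 , 1 , 0) ∷ (+ 2 , 16 , 2 , 0) ∷ (+ 1 , 17 , 3 , 0) ∷ (- 1 , 25 , 1 , 1) ∷
                (- 1 , 26 , 2 , 1) ∷ (- 1 , 27 , 3 , 1) ∷ (- 1 , 28 , 0 , 1) ∷ (- 3 , 29 , 1 , 1) ∷
                (- 4 , 30 , 2 , 1) ∷ (+ 1 , 31 , 1 , 1) ∷ (- 3 , 31 , 3 , 1) ∷ (+ 1 , 32 , 2 , 1) ∷
                (- 1 , 32 , 4 , 1) ∷ (+ 1 , 33 , 3 , 1) ∷ []))
      ∷ entry (R₁ 1 4) (rel₁ 1 4)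
          (poly ((- 1 , 17 , 0 , 1) ∷ (- 2 , 18 , 1 , 1) ∷ (- 2 , 19 , 2 , 1) ∷ (- 1 , 20 , 3 , 1) ∷
                (+ 1 , 23 , 0 , 1) ∷ (+ 2 , 24 , 1 , 1) ∷ (+ 2 , 25 , 2 , 1) ∷ (+ 1 , 26 , 3 , 1) ∷ []))
      ∷ entry (R₂ 1 3) (rel₂ 1 3)
          (poly ((- 1 , 5 , 0 , 0) ∷ (- 3 , 6 , 1 , 0) ∷ (- 3 , 7 , 2 , 0) ∷ (- 1 , 8 , 3 , 0) ∷
                (- 1 , 21 , 0 , 1) ∷ (- 2 , 22 , 1 , 1) ∷ (- 2 , 23 , 2 , 1) ∷ (- 1 , 24 , 3 , 1) ∷ []))
      ∷ entry (R₁ 1 5) (rel₁ 1 5)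
          (poly ((+ 1 , 0 , 0 , 0) ∷ (+ 2 , 1 , 1 , 0) ∷ (+ 1 , 2 , 2 , 0) ∷ (+ 1 , 16 , 0 , 1) ∷
                (+ 1 , 17 , 1 , 1) ∷ (+ 1 , 18 , 2 , 1) ∷ []))
      ∷ entry (R₁ 2 0) (rel₁ 2 0)
          (poly ((+ 1 , 37 , 2 , 2) ∷ (+ 3 , 38 , 3 , 2) ∷ (+ 3 , 39 , 4 , 2) ∷ (+ 1 , 40 , 5 , 2) ∷
                (+ 1 , 59 , 2 , 3) ∷ (+ 2 , 60 , 3 , 3) ∷ (+ 2 , 61 , 4 , 3) ∷ (+ 1 , 62 , 5 , 3) ∷ []))
      ∷ entry (R₂⁻ 2) (rel₂⁻ 2)
          (poly ((+ 1 , 29 , 2 , 1) ∷ (+ 3 , 30 , 3 , 1) ∷ (+ 3 , 31 , 4 , 1) ∷ (+ 1 , 32 , 5 , 1) ∷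
                (- 1 , 37 , 2 , 1) ∷ (- 3 , 38 , 3 , 1) ∷ (- 3 , 39 , 4 , 1) ∷ (- 1 , 40 , 5 , 1) ∷
                (+ 1 , 51 , 2 , 2) ∷ (+ 2 , 52 , 3 , 2) ∷ (+ 2 , 53 , 4 , 2) ∷ (+ 1 , 54 , 5 , 2) ∷
                (- 1 , 59 , 2 , 2) ∷ (- 2 , 60 , 3 , 2) ∷ (- 2 , 61 , 4 , 2) ∷ (- 1 , 62 , 5 , 2) ∷ []))
      ∷ entry (R₁ 2 1) (rel₁ 2 1)
          (poly ((+ 1 , 48 , 2 , 2) ∷ (+ 2 , 49 , 3 , 2) ∷ (+ 1 , 50 , 4 , 2) ∷ (+ 1 , 64 , 2 , 3) ∷
                (+ 1 , 65 , 3 , 3) ∷ (+ 1 , 66 , 4 , 3) ∷ []))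
      ∷ entry (R₂ 2 0) (rel₂ 2 0)
          (poly ((+ 1 , 40 , 2 , 1) ∷ (+ 2 , 41 , 3 , 1) ∷ (+ 1 , 42 , 4 , 1) ∷ (- 1 , 48 , 2 , 1) ∷
                (- 2 , 49 , 3 , 1) ∷ (- 1 , 50 , 4 , 1) ∷ (+ 1 , 56 , 2 , 2) ∷ (+ 1 , 57 , 3 , 2) ∷
                (+ 1 , 58 , 4 , 2) ∷ (- 1 , 64 , 2 , 2) ∷ (- 1 , 65 , 3 , 2) ∷ (- 1 , 66 , 4 , 2) ∷ []))
      ∷ entry (R₁ 2 2) (rel₁ 2 2)
          (poly ((- 1 , 22 , 1 , 1) ∷ (- 3 , 23 , 2 , 1) ∷ (- 3 , 24 , 3 , 1) ∷ (- 1 , 25 , 4 , 1) ∷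
                (- 1 , 28 , 1 , 1) ∷ (- 3 , 29 , 2 , 1) ∷ (- 3 , 30 , 3 , 1) ∷ (- 1 , 31 , 4 , 1) ∷
                (- 1 , 44 , 1 , 2) ∷ (- 2 , 45 , 2 , 2) ∷ (- 2 , 46 , 3 , 2) ∷ (- 1 , 47 , 4 , 2) ∷
                (- 1 , 50 , 1 , 2) ∷ (- 2 , 51 , 2 , 2) ∷ (- 2 , 52 , 3 , 2) ∷ (- 1 , 53 , 4 , 2) ∷ []))
      ∷ entry (R₂ 2 1) (rel₂ 2 1)
          (poly ((- 1 , 14 , 1 , 0) ∷ (- 3 , 15 , 2 , 0) ∷ (- 3 , 16 , 3 , 0) ∷ (- 1 , 17 , 4 , 0) ∷
                (+ 1 , 22 , 1 , 0) ∷ (+ 3 , 23 , 2 , 0) ∷ (+ 3 , 24 , 3 , 0) ∷ (+ 1 , 25 , 4 , 0) ∷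
                (- 1 , 36 , 1 , 1) ∷ (- 2 , 37 , 2 , 1) ∷ (- 2 , 38 , 3 , 1) ∷ (- 1 , 39 , 4 , 1) ∷
                (+ 1 , 44 , 1 , 1) ∷ (+ 2 , 45 , 2 , 1) ∷ (+ 2 , 46 , 3 , 1) ∷ (+ 1 , 47 , 4 , 1) ∷ []))
      ∷ entry (R₁ 2 3) (rel₁ 2 3)
          (poly ((- 1 , 27 , 1 , 1) ∷ (- 2 , 28 , 2 , 1) ∷ (- 1 , 29 , 3 , 1) ∷ (- 1 , 33 , 1 , 1) ∷
                (- 2 , 34 , 2 , 1) ∷ (- 1 , 35 , 3 , 1) ∷ (- 1 , 43 , 1 , 2) ∷ (- 1 , 44 , 2 , 2) ∷
                (- 1 , 45 , 3 , 2) ∷ (- 1 , 49 , 1 , 2) ∷ (- 1 , 50 , 2 , 2) ∷ (- 1 , 51 , 3 , 2) ∷ []))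
      ∷ entry (R₂ 2 2) (rel₂ 2 2)
          (poly ((- 1 , 13 , 1 , 0) ∷ (- 2 , 14 , 2 , 0) ∷ (- 1 , 15 , 3 , 0) ∷ (+ 1 , 21 , 1 , 0) ∷
                (+ 2 , 22 , 2 , 0) ∷ (+ 1 , 23 , 3 , 0) ∷ (- 1 , 29 , 1 , 1) ∷ (- 1 , 30 , 2 , 1) ∷
                (- 1 , 31 , 3 , 1) ∷ (+ 1 , 37 , 1 , 1) ∷ (+ 1 , 38 , 2 , 1) ∷ (+ 1 , 39 , 3 , 1) ∷ []))
      ∷ entry (R₁ 2 4) (rel₁ 2 4)
          (poly ((+ 1 , 1 , 0 , 0) ∷ (+ 3 , 2 , 1 , 0) ∷ (+ 3 , 3 , 2 , 0) ∷ (+ 1 , 4 , 3 , 0) ∷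
                (+ 1 , 23 , 0 , 1) ∷ (+ 2 , 24 , 1 , 1) ∷ (+ 2 , 25 , 2 , 1) ∷ (+ 1 , 26 , 3 , 1) ∷ []))
      ∷ entry (R₁ 2 5) (rel₁ 2 5)
          (poly ((+ 1 , 0 , 0 , 0) ∷ (+ 2 , 1 , 1 , 0) ∷ (+ 1 , 2 , 2 , 0) ∷ (+ 1 , 16 , 0 , 1) ∷
                (+ 1 , 17 , 1 , 1) ∷ (+ 1 , 18 , 2 , 1) ∷ []))
      ∷ entry Rsq rel-sq
          (poly ((+ 1 , 24 , 2 , 0) ∷ (+ 2 , 25 , 3 , 0) ∷ (+ 1 , 26 , 4 , 0) ∷ (+ 1 , 46 , 2 , 1) ∷
                  (+ 1 , 47 , 3 , 1) ∷ (+ 1 , 48 , 4 , 1) ∷ []) :* a 0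
          :+ poly ((- 1 , 27 , 0 , 0) ∷ (- 2 , 28 , 1 , 0) ∷ (- 2 , 29 , 2 , 0) ∷ (- 2 , 30 , 3 , 0) ∷
                  (- 2 , 31 , 4 , 0) ∷ (- 1 , 32 , 5 , 0) ∷ (+ 1 , 35 , 2 , 0) ∷ (+ 1 , 36 , 3 , 0) ∷
                  (- 1 , 49 , 0 , 1) ∷ (- 1 , 50 , 1 , 1) ∷ (- 1 , 51 , 2 , 1) ∷ (- 1 , 52 , 3 , 1) ∷
                  (- 1 , 53 , 4 , 1) ∷ (- 1 , 54 , 5 , 1) ∷ []) :* a 1
          :+ poly ((+ 1 , 55 , 1 , 1) ∷ (+ 1 , 56 , 2 , 1) ∷ (+ 1 , 57 , 3 , 1) ∷ []) :* a 2)
      ∷ []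

    recurrence≈0 : ⟦ recurrence ⟧ ρ ≈ 0#
    recurrence≈0 = trans (prove ρ recurrence (combination entries) refl) (combination≈0 entries)

mainTheorem5 : {c ℓ : Level} (R : CommutativeRing c ℓ) →
  let open CommutativeRing R
      open QDefs R
  in (q y : Carrier) (inv : ℕ → Carrier) →
     (∀ m → (1# ⊖ q ^ suc m) * inv m ≈ 1#) →
     (M : ℕ) →
     let a : ℕ → Carrier
         a = ã q y inv
         e = 6 ℕ.* M
         f = 12 ℕ.* M
         two = 1# + 1#
         three = 1# + 1# + 1#
     in 0# ≈
          q ^ (f ℕ.+ 24) * y ^ 2
            * (1# + two * y * q + y ^ 2 * q ^ 2 + q ^ (e ℕ.+ 22) + y * q ^ (e ℕ.+ 23)
               + y ^ 2 * q ^ (e ℕ.+ 24))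
            * a M
        ⊖ q ^ (f ℕ.+ 27) * (1# + y * q)
            * (1# + y * q + y ^ 2 * q ^ 2 ⊖ y ^ 2 * q ^ 8 + y ^ 3 * q ^ 3 + y ^ 4 * q ^ 4
               + q ^ (e ℕ.+ 22) + y ^ 2 * q ^ (e ℕ.+ 24) + y ^ 4 * q ^ (e ℕ.+ 26))
            * a (M ℕ.+ 1)
        ⊖ q ^ (e ℕ.+ 17)
            * (y + y * q ^ 2 + two * y ^ 2 * q + two * y ^ 2 * q ^ 3 + y ^ 3 * q ^ 2
               + y ^ 3 * q ^ 4 ⊖ q ^ (e ℕ.+ 15) + q ^ (e ℕ.+ 21) ⊖ two * y * q ^ (e ℕ.+ 16)
               + two * y * q ^ (e ℕ.+ 22) + y * q ^ (e ℕ.+ 24) ⊖ y * q ^ (f ℕ.+ 38)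
               ⊖ three * y ^ 2 * q ^ (e ℕ.+ 17) + two * y ^ 2 * q ^ (e ℕ.+ 23)
               + y ^ 2 * q ^ (e ℕ.+ 25) ⊖ y ^ 2 * q ^ (f ℕ.+ 39)
               ⊖ two * y ^ 3 * q ^ (e ℕ.+ 18) + two * y ^ 3 * q ^ (e ℕ.+ 24)
               + y ^ 3 * q ^ (e ℕ.+ 26) ⊖ y ^ 3 * q ^ (f ℕ.+ 40)
               ⊖ y ^ 4 * q ^ (e ℕ.+ 19) + y ^ 4 * q ^ (e ℕ.+ 25))
            * a (M ℕ.+ 2)
        ⊖ q ^ (e ℕ.+ 17) * (1# + q ^ 2 + q ^ 4) * (1# + y * q)
            * (1# + y * q + y * q ^ 3 + y ^ 2 * q ^ 2 + q ^ (e ℕ.+ 20) + y * q ^ (e ℕ.+ 21)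
               + y ^ 2 * q ^ (e ℕ.+ 22))
            * a (M ℕ.+ 3)
        + (1# ⊖ q ^ (e ℕ.+ 24))
            * (1# + two * y * q + y ^ 2 * q ^ 2 + q ^ (e ℕ.+ 16) + y * q ^ (e ℕ.+ 17)
               + y ^ 2 * q ^ (e ℕ.+ 18))
            * a (M ℕ.+ 4)
-- Rewriting 6M + k to k + 6M lets q ^ (k + 6M) compute to q * … * q ^ (6M), the value of qᴱ k.
mainTheorem5 R q y inv inv-inverse M
  rewrite ℕ.+-comm (6 ℕ.* M) 15 | ℕ.+-comm (6 ℕ.* M) 16 | ℕ.+-comm (6 ℕ.* M) 17 | ℕ.+-comm (6 ℕ.* M) 18
        | ℕ.+-comm (6 ℕ.* M) 19 | ℕ.+-comm (6 ℕ.* M) 20 | ℕ.+-comm (6 ℕ.* M) 21 | ℕ.+-comm (6 ℕ.* M) 22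
        | ℕ.+-comm (6 ℕ.* M) 23 | ℕ.+-comm (6 ℕ.* M) 24 | ℕ.+-comm (6 ℕ.* M) 25 | ℕ.+-comm (6 ℕ.* M) 26
        | ℕ.+-comm (12 ℕ.* M) 24 | ℕ.+-comm (12 ℕ.* M) 27 | ℕ.+-comm (12 ℕ.* M) 38
        | ℕ.+-comm (12 ℕ.* M) 39 | ℕ.+-comm (12 ℕ.* M) 40
  = CommutativeRing.sym R (RecurrenceCertificate.Certificate.recurrence≈0 R q y inv inv-inverse M)
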